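{- The following eight mesh patterns $(12,R)$ are pairwise equidistributed, where $R$ ranges over: $\{(1,2),(2,2)\}$, $\{(2,2),(2,1)\}$, $\{(0,1),(0,0)\}$, $\{(0,0),(1,0)\}$, $\{(1,2),(1,1)\}$, $\{(0,1),(1,1)\}$, $\{(1,1),(2,1)\}$, $\{(1,1),(1,0)\}$. Moreover, for each such pattern $p$, the numbers $s_{n,k}(p)$ satisfy $$s_{n,k}(p)=s_{n-1,k}(p)+(n-1)\,s_{n-1,k-1}(p)$$ (with $s_{m,-1}(p)=0$) with initial conditions $s_{0,0}(p)=s_{1,0}(p)=1$ and $s_{1,1}(p)=0$; consequently $s_{n,k}(p)=c(n,n-k)$, where $c(n,j)$ is the unsigned Stirling number of the first kind (the number of permutations of $[n]$ with exactly $j$ cycles). The bivariate exponential generating function is $$\sum_{n\ge0}\sum_{k\ge0}s_{n,k}(p)\frac{x^n}{n!}q^k=(1-xq)^{ -1/q}.$$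
   Context: For $R\subseteq\{0,1,2\}^2$ and $\pi=\pi_1\cdots\pi_n\in S_n$, an occurrence of the mesh pattern $(12,R)$ in $\pi$ is a pair of positions $i_1<i_2$ with $\pi_{i_1}<\pi_{i_2}$ such that, setting $x_0=0,x_1=i_1,x_2=i_2,x_3=n+1$ and $y_0=0,y_1=\pi_{i_1},y_2=\pi_{i_2},y_3=n+1$, for every $(a,b)\in R$ there is no index $k$ with $x_a<k<x_{a+1}$ and $y_b<\pi_k<y_{b+1}$. $s_{n,k}(p)$ is the number of $\pi\in S_n$ with exactly $k$ occurrences of $p$; $p_1,p_2$ are equidistributed if $s_{n,k}(p_1)=s_{n,k}(p_2)$ for all $n,k\ge 0$. -}

module Defs where

open import Data.Bool using (Bool; true; false; _∧_; not; if_then_else_)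
open import Data.Nat using (ℕ; zero; suc; _+_; _*_; _<ᵇ_; _≤ᵇ_; _≡ᵇ_)
open import Data.Fin using (Fin; toℕ; inject₁) renaming (zero to fz; suc to fs)
open import Data.Vec using (Vec; []; _∷_; lookup)
open import Data.List using (List; []; _∷_; map; concatMap; length; filterᵇ; allFin; upTo; foldr)
open import Data.Nat.ListAction using (sum; product)
open import Data.Product using (_×_; _,_)

all : ∀ {A : Set} → (A → Bool) → List A → Bool
all p = foldr (λ x b → p x ∧ b) true

any : ∀ {A : Set} → (A → Bool) → List A → Bool
any p xs = not (all (λ x → not (p x)) xs)

f0 f1 f2 : Fin 3
f0 = fz
f1 = fs fz
f2 = fs (fs fz)

Shading : Set
Shading = List (Fin 3 × Fin 3)

-- A permutation π ∈ S_n is represented by its one-line notation as a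
-- vector of length n with entries in Fin n (entry e stands for value toℕ e + 1,
-- position i stands for index toℕ i + 1), that is injective.
allVecs : (n m : ℕ) → List (Vec (Fin m) n)
allVecs zero    m = [] ∷ []
allVecs (suc n) m = concatMap (λ x → map (x ∷_) (allVecs n m)) (allFin m)

isPerm : ∀ {n} → Vec (Fin n) n → Bool
isPerm {n} v = all (λ i → all (λ j → (toℕ i ≡ᵇ toℕ j) ∨' not (toℕ (lookup v i) ≡ᵇ toℕ (lookup v j))) (allFin n)) (allFin n)
  where
  _∨'_ : Bool → Bool → Bool
  true ∨' _ = true
  false ∨' b = b

perms : (n : ℕ) → List (Vec (Fin n) n)
perms n = filterᵇ isPerm (allVecs n n)

pos : ∀ {n} → Fin n → ℕ
pos i = suc (toℕ i)

val : ∀ {n} → Vec (Fin n) n → Fin n → ℕ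
val v i = suc (toℕ (lookup v i))

grid : ℕ → ℕ → ℕ → Fin 4 → ℕ
grid u w n fz                = 0
grid u w n (fs fz)           = u
grid u w n (fs (fs fz))      = w
grid u w n (fs (fs (fs fz))) = suc n

inBox : ∀ {n} → Vec (Fin n) n → Fin n → Fin n → Fin 3 × Fin 3 → Fin n → Bool
inBox {n} v i₁ i₂ (a , b) k =
  (grid (pos i₁) (pos i₂) n (inject₁ a) <ᵇ pos k) ∧
  (pos k <ᵇ grid (pos i₁) (pos i₂) n (fs a)) ∧
  (grid (val v i₁) (val v i₂) n (inject₁ b) <ᵇ val v k) ∧
  (val v k <ᵇ grid (val v i₁) (val v i₂) n (fs b))

isOcc : ∀ {n} → Shading → Vec (Fin n) n → Fin n → Fin n → Bool
isOcc {n} R v i₁ i₂ =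
  (pos i₁ <ᵇ pos i₂) ∧ (val v i₁ <ᵇ val v i₂) ∧
  all (λ box → not (any (inBox v i₁ i₂ box) (allFin n))) R

occ : ∀ {n} → Shading → Vec (Fin n) n → ℕ
occ {n} R v = length ((concatMap (λ i₁ → filterᵇ (isOcc R v i₁) (allFin n)) (allFin n)))

s : Shading → ℕ → ℕ → ℕ
s R n k = length (filterᵇ (λ v → occ R v ≡ᵇ k) (perms n))

iter : ∀ {n} → Vec (Fin n) n → ℕ → Fin n → Fin n
iter v zero    i = i
iter v (suc t) i = lookup v (iter v t i)

-- number of cycles of π: each cycle is counted once, via its least element
-- (i is the least element of its cycle iff i ≤ π^t(i) for all t < n)
cycles : ∀ {n} → Vec (Fin n) n → ℕ
cycles {n} v = length (filterᵇ (λ i → all (λ t → toℕ i ≤ᵇ toℕ (iter v t i)) (upTo n)) (allFin n))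

stirling1 : ℕ → ℕ → ℕ
stirling1 n j = length (filterᵇ (λ v → cycles v ≡ᵇ j) (perms n))

R₁ R₂ R₃ R₄ R₅ R₆ R₇ R₈ : Shading
R₁ = (f1 , f2) ∷ (f2 , f2) ∷ []
R₂ = (f2 , f2) ∷ (f2 , f1) ∷ []
R₃ = (f0 , f1) ∷ (f0 , f0) ∷ []
R₄ = (f0 , f0) ∷ (f1 , f0) ∷ []
R₅ = (f1 , f2) ∷ (f1 , f1) ∷ []
R₆ = (f0 , f1) ∷ (f1 , f1) ∷ []
R₇ = (f1 , f1) ∷ (f2 , f1) ∷ []
R₈ = (f1 , f1) ∷ (f1 , f0) ∷ []

theShadings : List Shading
theShadings = R₁ ∷ R₂ ∷ R₃ ∷ R₄ ∷ R₅ ∷ R₆ ∷ R₇ ∷ R₈ ∷ []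

genPoly : Shading → ℕ → ℕ → ℕ
genPoly R n q = sum (map (λ k → s R n k * q Data.Nat.^ k) (upTo (suc n)))

-- Π_{i < n} (1 + i q) = n! [x^n] (1 - x q)^{-1/q}
egfCoeff : ℕ → ℕ → ℕ
egfCoeff n q = product (map (λ i → 1 + i * q) (upTo n))

{-# OPTIONS --safe #-}
-- An occurrence (i , j) of any of the eight patterns is pinned down by one of its points: for
-- R₁, R₂, R₅, R₇ the point j is the highest, rightmost, leftmost or lowest point north-east of
-- i, and for R₃, R₄, R₆, R₈ the point i is the leftmost, lowest, highest or rightmost point
-- south-west of j; the two shaded boxes are exactly where a better candidate would lie.  So
-- occurrences count the entries that are not right-to-left maxima, resp. not left-to-right
-- minima.  These statistics, and n minus the number of cycles, grow by one under all but one
-- of the n + 1 ways of building a permutation of [n + 1] from one of [n] (prepend a first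
-- entry, append a last entry, or splice the new element into a cycle).  This is the
-- recurrence s(n+1, k+1) = s(n, k+1) + n s(n, k), whose solution is c(n, n - k), with
-- generating polynomial Σ_k s(n, k) q^k = Π_{i<n} (1 + i q).
module Submission where

import Data.Nat.Properties as ℕₚ
open import Algebra.Properties.CommutativeMonoid.Sum ℕₚ.+-0-commutativeMonoid
  using (sum-syntax; sum-cong-≗; sum-remove; sum-init-last; sum-permute; ∑-comm; ∑-distrib-+)
open import Algebra.Properties.Semiring.Sum ℕₚ.+-*-semiring using (*-distribˡ-sum)
open import Data.Bool using (Bool; true; false; T; _∧_; not)
open import Data.Bool.Properties using (T-∧; not-involutive)
open import Data.Empty using (⊥-elim)
open import Data.Fin as Fin using (Fin; toℕ; inject₁; fromℕ; punchIn; punchOut; _≟_)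
  renaming (zero to fz; suc to fs)
open import Data.Fin.Permutation using (transpose)
import Data.Fin.Permutation.Components as Components
open import Data.Fin.Properties as Finₚ
  using ( toℕ-injective; toℕ-fromℕ; toℕ-inject₁; toℕ<n; ≤fromℕ; fromℕ≢inject₁; inject₁-injective
        ; punchIn-injective; punchInᵢ≢i; punchIn-mono-≤; punchIn-cancel-≤; punchOut-injective
        ; any?; ¬∀⟶∃¬; pigeonhole)
open import Data.List as List
  using (List; []; _∷_; _++_; map; concatMap; length; filterᵇ; tabulate; allFin; applyUpTo; upTo)
open import Data.List.Membership.Propositional using (_∈_)
open import Data.List.Properties using (length-++; filter-++; map-applyUpTo; applyUpTo-∷ʳ)
open import Data.List.Relation.Unary.Any using (here; there)
open import Data.Nat
  using (ℕ; zero; suc; _+_; _*_; _^_; _∸_; _≤_; _<_; _<?_; _≡ᵇ_; _≤ᵇ_; _<ᵇ_; s<s; s<s⁻¹; z<s)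
open import Data.Nat.Induction using (<-rec)
open import Data.Nat.ListAction as ListAction using (product)
open import Data.Nat.ListAction.Properties using (product-++)
open import Data.Nat.Tactic.RingSolver using (solve-∀)
open import Data.Product using (_×_; _,_; proj₁; proj₂; ∃)
open import Data.Sum using (_⊎_; inj₁; inj₂)
open import Data.Vec using (Vec; []; _∷_; _∷ʳ_)
import Data.Vec as Vec
open import Data.Vec.Properties using (tabulate∘lookup; lookup-map)
open import Data.Vec.Relation.Unary.All as All using (All; []; _∷_)
import Data.Vec.Relation.Unary.All.Properties as All
open import Data.Vec.Relation.Unary.AllPairs using (allPairs?)
open import Data.Vec.Relation.Unary.Any as Any using (Any)
open import Data.Vec.Relation.Unary.Unique.Propositional using (Unique; []; _∷_)
import Data.Vec.Relation.Unary.Unique.Propositional.Properties as Unique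
open import Defs
open import Function using (_∘_; _⇔_; mk⇔; Equivalence)
open import Function.Construct.Composition using (_⇔-∘_)
open import Function.Construct.Symmetry using (⇔-sym)
open import Relation.Binary.Definitions using (tri<; tri≈; tri>)
open import Relation.Binary.PropositionalEquality
import Relation.Binary.Properties.TotalOrder as TotalOrderProperties
open import Relation.Binary.Structures using (IsTotalOrder)
open import Relation.Nullary using (¬_; ¬?; Dec; does; isYes; yes; no)
open import Relation.Nullary.Decidable
  using (does-⇔; T?; dec-true; dec-false; toWitness; fromWitness; _×-dec_)
open import Relation.Unary using (Decidable)

-- Indicators, finite sums and counting

𝟙 : Bool → ℕ
𝟙 true  = 1
𝟙 false = 0

𝟙-true : ∀ {b} → T b → 𝟙 b ≡ 1
𝟙-true {true} _ = refl

𝟙-false : ∀ {b} → ¬ T b → 𝟙 b ≡ 0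
𝟙-false {true}  ¬t = ⊥-elim (¬t _)
𝟙-false {false} _  = refl

𝟙-+-not : ∀ b → 𝟙 b + 𝟙 (not b) ≡ 1
𝟙-+-not true  = refl
𝟙-+-not false = refl

T-⇔⇒≡ : ∀ {a b} → T a ⇔ T b → a ≡ b
T-⇔⇒≡ a⇔b = does-⇔ a⇔b (T? _) (T? _)

𝟙-does-cong : ∀ {P Q : Set} → P ⇔ Q → (p : Dec P) (q : Dec Q) → 𝟙 (does p) ≡ 𝟙 (does q)
𝟙-does-cong P⇔Q p q = cong 𝟙 (does-⇔ P⇔Q p q)

𝟙-yes : ∀ {P : Set} → P → (p : Dec P) → 𝟙 (does p) ≡ 1
𝟙-yes x p = cong 𝟙 (dec-true p x)

𝟙-no : ∀ {P : Set} → ¬ P → (p : Dec P) → 𝟙 (does p) ≡ 0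
𝟙-no ¬x p = cong 𝟙 (dec-false p ¬x)

∑-const : ∀ n c → ∑[ i < n ] c ≡ n * c
∑-const zero    c = refl
∑-const (suc n) c = cong (c +_) (∑-const n c)

∑-zero : ∀ {n} {f : Fin n → ℕ} → (∀ i → f i ≡ 0) → ∑[ i < n ] f i ≡ 0
∑-zero {n} f≡0 = trans (sum-cong-≗ {n} f≡0) (trans (∑-const n 0) (ℕₚ.*-zeroʳ n))

∑-𝟙-unique : ∀ {n} {O : Fin n → Bool} (j : Fin n) → T (O j) → (∀ k → T (O k) → k ≡ j) →
             ∑[ k < n ] 𝟙 (O k) ≡ 1
∑-𝟙-unique {suc n} {O} j oj only-j = begin
  ∑[ k < suc n ] 𝟙 (O k)                    ≡⟨ sum-remove {i = j} (𝟙 ∘ O) ⟩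
  𝟙 (O j) + ∑[ k < n ] 𝟙 (O (punchIn j k))  ≡⟨ cong₂ _+_ (𝟙-true oj) (∑-zero others) ⟩
  1                                         ∎
  where
  open ≡-Reasoning
  others : ∀ k → 𝟙 (O (punchIn j k)) ≡ 0
  others k = 𝟙-false (punchInᵢ≢i j k ∘ only-j (punchIn j k))

∃-cong : ∀ {n} {P Q : Fin n → Set} → (∀ i → P i ⇔ Q i) → ∃ P ⇔ ∃ Q
∃-cong P⇔Q = mk⇔ (λ (i , p) → i , Equivalence.to (P⇔Q i) p)
                 (λ (i , q) → i , Equivalence.from (P⇔Q i) q)

T-<ᵇ : ∀ {a b} → T (a <ᵇ b) ⇔ a < b
T-<ᵇ {a} {b} = mk⇔ (ℕₚ.<ᵇ⇒< a b) ℕₚ.<⇒<ᵇ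

T-not : ∀ {b} → T (not b) ⇔ (¬ T b)
T-not {true}  = mk⇔ (λ ()) (λ ¬t → ¬t _)
T-not {false} = mk⇔ (λ _ ()) _

T-all-tabulate : ∀ {A : Set} {n} (p : A → Bool) (f : Fin n → A) →
                 T (all p (tabulate f)) ⇔ (∀ i → T (p (f i)))
T-all-tabulate {n = zero}  p f = mk⇔ (λ _ ()) _
T-all-tabulate {n = suc n} p f = mk⇔
  (λ t → λ { fz → proj₁ (to T-∧ t) ; (fs i) → to (T-all-tabulate p (f ∘ fs)) (proj₂ (to T-∧ t)) i })
  (λ t → from T-∧ (t fz , from (T-all-tabulate p (f ∘ fs)) (t ∘ fs)))
  where open Equivalence

T-all-applyUpTo : ∀ {A : Set} n (p : A → Bool) (f : ℕ → A) →
                  T (all p (applyUpTo f n)) ⇔ (∀ t → t < n → T (p (f t)))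
T-all-applyUpTo zero    p f = mk⇔ (λ _ _ ()) _
T-all-applyUpTo (suc n) p f = mk⇔
  (λ t → λ { zero    _         → proj₁ (to T-∧ t)
           ; (suc s) (s<s s<n) → to (T-all-applyUpTo n p (f ∘ suc)) (proj₂ (to T-∧ t)) s s<n })
  (λ t → from T-∧ (t 0 z<s , from (T-all-applyUpTo n p (f ∘ suc)) (λ s s<n → t (suc s) (s<s s<n))))
  where open Equivalence

T-none : ∀ {A : Set} {n} (p : A → Bool) (f : Fin n → A) →
         T (not (any p (tabulate f))) ⇔ (∀ k → ¬ T (p (f k)))
T-none p f rewrite not-involutive (all (λ x → not (p x)) (tabulate f)) = mk⇔
  (λ none k → to T-not (to (T-all-tabulate _ f) none k))
  (λ none → from (T-all-tabulate _ f) (λ k → from T-not (none k)))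
  where open Equivalence

count : {A : Set} → (A → Bool) → List A → ℕ
count p xs = length (filterᵇ p xs)

module _ {A : Set} where

  count-∷ : ∀ (p : A → Bool) x xs → count p (x ∷ xs) ≡ 𝟙 (p x) + count p xs
  count-∷ p x xs with p x
  ... | true  = refl
  ... | false = refl

  count-++ : ∀ (p : A → Bool) xs ys → count p (xs ++ ys) ≡ count p xs + count p ys
  count-++ p xs ys = trans (cong length (filter-++ (T? ∘ p) xs ys)) (length-++ (filterᵇ p xs))

  count-none : ∀ {p : A → Bool} → (∀ x → p x ≡ false) → ∀ xs → count p xs ≡ 0
  count-none p≡false []       = refl
  count-none {p} p≡false (x ∷ xs) =
    trans (count-∷ p x xs) (cong₂ _+_ (cong 𝟙 (p≡false x)) (count-none p≡false xs))

  count-cong : ∀ {p q : A → Bool} → (∀ x → p x ≡ q x) → ∀ xs → count p xs ≡ count q xs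
  count-cong p≗q []       = refl
  count-cong {p} {q} p≗q (x ∷ xs) = begin
    count p (x ∷ xs)         ≡⟨ count-∷ p x xs ⟩
    𝟙 (p x) + count p xs     ≡⟨ cong₂ _+_ (cong 𝟙 (p≗q x)) (count-cong p≗q xs) ⟩
    𝟙 (q x) + count q xs     ≡⟨ count-∷ q x xs ⟨
    count q (x ∷ xs)         ∎
    where open ≡-Reasoning

  count-filterᵇ : ∀ (p q : A → Bool) xs → count p (filterᵇ q xs) ≡ count (λ x → q x ∧ p x) xs
  count-filterᵇ p q []       = refl
  count-filterᵇ p q (x ∷ xs) with q x | count-∷ (λ x → q x ∧ p x) x xs
  ... | false | ∷-step = trans (count-filterᵇ p q xs) (sym ∷-step)
  ... | true  | ∷-step =
    trans (count-∷ p x (filterᵇ q xs)) (trans (cong (𝟙 (p x) +_) (count-filterᵇ p q xs)) (sym ∷-step))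

  count-filterᵇ-cong : ∀ {p p′ : A → Bool} q → (∀ x → T (q x) → p x ≡ p′ x) →
                       ∀ xs → count p (filterᵇ q xs) ≡ count p′ (filterᵇ q xs)
  count-filterᵇ-cong q p≗p′ []       = refl
  count-filterᵇ-cong {p} {p′} q p≗p′ (x ∷ xs) with q x in qx
  ... | false = count-filterᵇ-cong q p≗p′ xs
  ... | true  = begin
    count p (x ∷ filterᵇ q xs)         ≡⟨ count-∷ p x _ ⟩
    𝟙 (p x) + count p (filterᵇ q xs)   ≡⟨ cong₂ _+_ (cong 𝟙 (p≗p′ x (subst T (sym qx) _)))
                                                     (count-filterᵇ-cong q p≗p′ xs) ⟩
    𝟙 (p′ x) + count p′ (filterᵇ q xs) ≡⟨ count-∷ p′ x _ ⟨
    count p′ (x ∷ filterᵇ q xs)        ∎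
    where open ≡-Reasoning

  count-tabulate : ∀ {n} (p : A → Bool) (f : Fin n → A) → count p (tabulate f) ≡ ∑[ i < n ] 𝟙 (p (f i))
  count-tabulate {zero}  p f = refl
  count-tabulate {suc n} p f =
    trans (count-∷ p (f fz) _) (cong (𝟙 (p (f fz)) +_) (count-tabulate p (f ∘ fs)))

module _ {A B : Set} where

  count-map : ∀ (p : B → Bool) (f : A → B) xs → count p (map f xs) ≡ count (p ∘ f) xs
  count-map p f []       = refl
  count-map p f (x ∷ xs) =
    trans (count-∷ p (f x) (map f xs))
          (trans (cong (𝟙 (p (f x)) +_) (count-map p f xs)) (sym (count-∷ (p ∘ f) x xs)))

  count-concatMap-tabulate : ∀ {n} (p : B → Bool) (f : A → List B) (g : Fin n → A) →
                             count p (concatMap f (tabulate g)) ≡ ∑[ i < n ] count p (f (g i))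
  count-concatMap-tabulate {zero}  p f g = refl
  count-concatMap-tabulate {suc n} p f g =
    trans (count-++ p (f (g fz)) _) (cong (count p (f (g fz)) +_) (count-concatMap-tabulate p f (g ∘ fs)))

  length-concatMap-tabulate : ∀ {n} (f : A → List B) (g : Fin n → A) →
                              length (concatMap f (tabulate g)) ≡ ∑[ i < n ] length (f (g i))
  length-concatMap-tabulate {zero}  f g = refl
  length-concatMap-tabulate {suc n} f g =
    trans (length-++ (f (g fz))) (cong (length (f (g fz)) +_) (length-concatMap-tabulate f (g ∘ fs)))

-- Words and permutations

count-allVecs-∷ : ∀ n m (P : Vec (Fin m) (suc n) → Bool) →
                  count P (allVecs (suc n) m) ≡ ∑[ x < m ] count (P ∘ (x ∷_)) (allVecs n m)
count-allVecs-∷ n m P = trans (count-concatMap-tabulate P (λ x → map (x ∷_) (allVecs n m)) (λ x → x))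
                              (sum-cong-≗ (λ x → count-map P (x ∷_) (allVecs n m)))

count-allVecs-∷ʳ : ∀ n m (P : Vec (Fin m) (suc n) → Bool) →
                   count P (allVecs (suc n) m) ≡ ∑[ x < m ] count (P ∘ (_∷ʳ x)) (allVecs n m)
count-allVecs-∷ʳ zero    m P = trans (count-allVecs-∷ zero m P) (sum-cong-≗ {m} λ x →
  trans (count-∷ (P ∘ (x ∷_)) [] []) (sym (count-∷ (P ∘ (_∷ʳ x)) [] [])))
count-allVecs-∷ʳ (suc n) m P = begin
  count P (allVecs (suc (suc n)) m)
    ≡⟨ count-allVecs-∷ (suc n) m P ⟩
  ∑[ x < m ] count (P ∘ (x ∷_)) (allVecs (suc n) m)
    ≡⟨ sum-cong-≗ (λ x → count-allVecs-∷ʳ n m (P ∘ (x ∷_))) ⟩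
  ∑[ x < m ] ∑[ y < m ] count (λ w → P (x ∷ (w ∷ʳ y))) (allVecs n m)
    ≡⟨ ∑-comm (λ x y → count (λ w → P (x ∷ (w ∷ʳ y))) (allVecs n m)) ⟩
  ∑[ y < m ] ∑[ x < m ] count (λ w → P (x ∷ (w ∷ʳ y))) (allVecs n m)
    ≡⟨ sum-cong-≗ (λ y → count-allVecs-∷ n m (P ∘ (_∷ʳ y))) ⟨
  ∑[ y < m ] count (P ∘ (_∷ʳ y)) (allVecs (suc n) m)
    ∎
  where open ≡-Reasoning

record Skips {n} (x : Fin (suc n)) (e : Fin n → Fin (suc n)) : Set where
  field
    injective : ∀ {a b} → e a ≡ e b → a ≡ b
    avoids    : ∀ a → e a ≢ x
    ∑-split   : ∀ (g : Fin (suc n) → ℕ) → ∑[ i < suc n ] g i ≡ g x + ∑[ i < n ] g (e i)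

punchIn-skips : ∀ {n} (x : Fin (suc n)) → Skips x (punchIn x)
punchIn-skips x = record
  { injective = punchIn-injective x _ _
  ; avoids    = punchInᵢ≢i x
  ; ∑-split   = λ g → sum-remove {i = x} g
  }

inject₁-skips : ∀ {n} → Skips (fromℕ n) inject₁
inject₁-skips = record
  { injective = inject₁-injective
  ; avoids    = λ a → fromℕ≢inject₁ ∘ sym
  ; ∑-split   = λ g → trans (sum-init-last g) (ℕₚ.+-comm _ (g (fromℕ _)))
  }

transpose-matchʳ : ∀ {n} (i j : Fin n) → Components.transpose i j j ≡ i
transpose-matchʳ i j with j ≟ i
... | yes j≡i = j≡i
... | no  _   rewrite dec-true (j ≟ j) refl = refl

-- Appending x to Vec.map (relabel x) u
-- splices the new element n into the cycle of u just before x (or adds it as a fixed point if x = n).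
relabel : ∀ {n} → Fin (suc n) → Fin n → Fin (suc n)
relabel {n} x z = Components.transpose x (fromℕ n) (inject₁ z)

relabel-skips : ∀ {n} (x : Fin (suc n)) → Skips x (relabel x)
relabel-skips {n} x = record
  { injective = λ {a} {b} eq →
      inject₁-injective (trans (sym (undo (inject₁ a))) (trans (cong τ⁻¹ eq) (undo (inject₁ b))))
  ; avoids    = λ a eq → fromℕ≢inject₁
      (trans (sym (transpose-matchʳ (fromℕ n) x)) (trans (cong τ⁻¹ (sym eq)) (undo (inject₁ a))))
  ; ∑-split   = λ g → begin
      ∑[ i < suc n ] g i                              ≡⟨ sum-permute g (transpose x (fromℕ n)) ⟩
      ∑[ i < suc n ] g (τ i)                          ≡⟨ sum-init-last {n} (g ∘ τ) ⟩
      ∑[ i < n ] g (relabel x i) + g (τ (fromℕ n))    ≡⟨ ℕₚ.+-comm (∑[ i < n ] g (relabel x i)) _ ⟩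
      g (τ (fromℕ n)) + ∑[ i < n ] g (relabel x i)    ≡⟨ cong (λ y → g y + ∑[ i < n ] g (relabel x i))
                                                              (transpose-matchʳ x (fromℕ n)) ⟩
      g x + ∑[ i < n ] g (relabel x i)                ∎
  }
  where
  open ≡-Reasoning
  τ τ⁻¹ : Fin (suc n) → Fin (suc n)
  τ   = Components.transpose x (fromℕ n)
  τ⁻¹ = Components.transpose (fromℕ n) x
  undo : ∀ k → τ⁻¹ (τ k) ≡ k
  undo k = Components.transpose-inverse (fromℕ n) x

count-allVecs-skipping : ∀ {n m} {x : Fin (suc m)} {e : Fin m → Fin (suc m)} → Skips x e →
                         (P : Vec (Fin (suc m)) n → Bool) → (∀ w → Any (x ≡_) w → P w ≡ false) →
                         count P (allVecs n (suc m)) ≡ count (P ∘ Vec.map e) (allVecs n m)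
count-allVecs-skipping {zero} skips P _ = trans (count-∷ P [] []) (sym (count-∷ (P ∘ Vec.map _) [] []))
count-allVecs-skipping {suc n} {m} {x} {e} skips P P∋x = begin
  count P (allVecs (suc n) (suc m))
    ≡⟨ count-allVecs-∷ n (suc m) P ⟩
  ∑[ y < suc m ] count (P ∘ (y ∷_)) (allVecs n (suc m))
    ≡⟨ Skips.∑-split skips _ ⟩
  count (P ∘ (x ∷_)) (allVecs n (suc m)) + ∑[ z < m ] count (P ∘ (e z ∷_)) (allVecs n (suc m))
    ≡⟨ cong₂ _+_ (count-none (λ w → P∋x (x ∷ w) (Any.here refl)) (allVecs n (suc m)))
                 (sum-cong-≗ {m} λ z → count-allVecs-skipping skips (P ∘ (e z ∷_))
                                          (λ w x∈w → P∋x (e z ∷ w) (Any.there x∈w))) ⟩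
  ∑[ z < m ] count (λ u → P (e z ∷ Vec.map e u)) (allVecs n m)
    ≡⟨ count-allVecs-∷ n m (P ∘ Vec.map e) ⟨
  count (P ∘ Vec.map e) (allVecs (suc n) m)
    ∎
  where open ≡-Reasoning

module _ {A : Set} where

  All-∷ʳ⁺ : ∀ {P : A → Set} {n y} {w : Vec A n} → All P w → P y → All P (w ∷ʳ y)
  All-∷ʳ⁺ []         py = py ∷ []
  All-∷ʳ⁺ (px ∷ pxs) py = px ∷ All-∷ʳ⁺ pxs py

  All-∷ʳ⁻ : ∀ {P : A → Set} {n y} (w : Vec A n) → All P (w ∷ʳ y) → All P w × P y
  All-∷ʳ⁻ []      (py ∷ [])  = [] , py
  All-∷ʳ⁻ (x ∷ w) (px ∷ pxs) with All-∷ʳ⁻ w pxs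
  ... | pw , py = px ∷ pw , py

  Unique-∷ʳ⁺ : ∀ {n y} {w : Vec A n} → All (_≢ y) w → Unique w → Unique (w ∷ʳ y)
  Unique-∷ʳ⁺ []           []         = [] ∷ []
  Unique-∷ʳ⁺ (x≢y ∷ w≢y) (x∉w ∷ uw) = All-∷ʳ⁺ x∉w x≢y ∷ Unique-∷ʳ⁺ w≢y uw

  Unique-∷ʳ⁻ : ∀ {n y} (w : Vec A n) → Unique (w ∷ʳ y) → All (_≢ y) w × Unique w
  Unique-∷ʳ⁻ []      _            = [] , []
  Unique-∷ʳ⁻ (x ∷ w) (x∉wy ∷ uwy) with All-∷ʳ⁻ w x∉wy | Unique-∷ʳ⁻ w uwy
  ... | x∉w , x≢y | w≢y , uw = x≢y ∷ w≢y , x∉w ∷ uw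

  Unique-map⁻ : ∀ {B : Set} {f : A → B} {n} (u : Vec A n) → Unique (Vec.map f u) → Unique u
  Unique-map⁻ []      []           = []
  Unique-map⁻ (x ∷ u) (fx∉fu ∷ uu) =
    All.map (λ fx≢fy x≡y → fx≢fy (cong _ x≡y)) (All.map⁻ fx∉fu) ∷ Unique-map⁻ u uu

unique? : ∀ {m n} (w : Vec (Fin m) n) → Dec (Unique w)
unique? = allPairs? (λ a b → ¬? (a ≟ b))

isUnique : ∀ {m n} → Vec (Fin m) n → Bool
isUnique w = isYes (unique? w)

T-isUnique : ∀ {m n} {w : Vec (Fin m) n} → T (isUnique w) ⇔ Unique w
T-isUnique {w = w} = mk⇔ (toWitness {a? = unique? w}) (fromWitness {a? = unique? w})

isUnique-cong : ∀ {m n m′ n′} {w : Vec (Fin m) n} {w′ : Vec (Fin m′) n′} →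
                Unique w ⇔ Unique w′ → isUnique w ≡ isUnique w′
isUnique-cong w⇔w′ = T-⇔⇒≡ (⇔-sym T-isUnique ⇔-∘ (w⇔w′ ⇔-∘ T-isUnique))

isUnique-false : ∀ {m n} {w : Vec (Fin m) n} → ¬ Unique w → isUnique w ≡ false
isUnique-false ¬u = T-⇔⇒≡ (mk⇔ (¬u ∘ Equivalence.to T-isUnique) λ ())

¬Unique-∷ : ∀ {m n} {x : Fin m} {w : Vec (Fin m) n} → Any (x ≡_) w → ¬ Unique (x ∷ w)
¬Unique-∷ x∈w (x∉w ∷ _) = All.lookup x∉w x∈w refl

¬Unique-∷ʳ : ∀ {m n} {y : Fin m} {w : Vec (Fin m) n} → Any (y ≡_) w → ¬ Unique (w ∷ʳ y)
¬Unique-∷ʳ {w = w} y∈w u = All.lookup (proj₁ (Unique-∷ʳ⁻ w u)) y∈w refl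

module _ {n} {x : Fin (suc n)} {e : Fin n → Fin (suc n)} (skips : Skips x e) where
  open Skips skips

  Unique-∷-skips : (u : Vec (Fin n) n) → Unique (x ∷ Vec.map e u) ⇔ Unique u
  Unique-∷-skips u = mk⇔ (λ { (_ ∷ uu) → Unique-map⁻ u uu })
    (λ uu → All.map⁺ (All.universal (λ a x≡ea → avoids a (sym x≡ea)) u) ∷ Unique.map⁺ injective uu)

  Unique-∷ʳ-skips : (u : Vec (Fin n) n) → Unique (Vec.map e u ∷ʳ x) ⇔ Unique u
  Unique-∷ʳ-skips u = mk⇔ (Unique-map⁻ u ∘ proj₂ ∘ Unique-∷ʳ⁻ (Vec.map e u))
    (λ uu → Unique-∷ʳ⁺ (All.map⁺ (All.universal avoids u)) (Unique.map⁺ injective uu))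

Injective : ∀ {m n} → Vec (Fin m) n → Set
Injective {n = n} v = ∀ (i j : Fin n) → Vec.lookup v i ≡ Vec.lookup v j → i ≡ j

-- The pairwise test of isPerm is local to Defs, so it can only be reached by with-abstraction.
isPerm⇒Injective : ∀ {n} (v : Vec (Fin n) n) → T (isPerm v) → Injective v
isPerm⇒Injective v t i j vᵢ≡vⱼ
  with toℕ i ≡ᵇ toℕ j in i≟j | toℕ (Vec.lookup v i) ≡ᵇ toℕ (Vec.lookup v j) in vᵢ≟vⱼ
     | Equivalence.to (T-all-tabulate _ _) (Equivalence.to (T-all-tabulate _ _) t i) j
... | true  | _     | _  = toℕ-injective (ℕₚ.≡ᵇ⇒≡ _ _ (subst T (sym i≟j) _))
... | false | false | _  = ⊥-elim (subst T vᵢ≟vⱼ (ℕₚ.≡⇒≡ᵇ _ _ (cong toℕ vᵢ≡vⱼ)))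
... | false | true  | ()

Injective⇒isPerm : ∀ {n} (v : Vec (Fin n) n) → Injective v → T (isPerm v)
Injective⇒isPerm {n} v inj with isPerm v in isPerm≡
... | true  = _
... | false with ¬∀⟶∃¬ n _ (λ i → T? _) (subst T isPerm≡ ∘ Equivalence.from (T-all-tabulate _ _))
... | i , ¬tᵢ with ¬∀⟶∃¬ n _ (λ j → T? _) (¬tᵢ ∘ Equivalence.from (T-all-tabulate _ _))
... | j , ¬tᵢⱼ with toℕ i ≡ᵇ toℕ j in i≟j | toℕ (Vec.lookup v i) ≡ᵇ toℕ (Vec.lookup v j) in vᵢ≟vⱼ
... | true  | _     = ⊥-elim (¬tᵢⱼ _)
... | false | false = ⊥-elim (¬tᵢⱼ _)
... | false | true  =
  subst T i≟j (ℕₚ.≡⇒≡ᵇ _ _ (cong toℕ (inj i j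
    (toℕ-injective (ℕₚ.≡ᵇ⇒≡ _ _ (subst T (sym vᵢ≟vⱼ) _))))))

Injective⇔Unique : ∀ {m n} (v : Vec (Fin m) n) → Injective v ⇔ Unique v
Injective⇔Unique v = mk⇔
  (λ inj → subst Unique (tabulate∘lookup v) (Unique.tabulate⁺ (λ {i} {j} → inj i j)))
  (λ u → Unique.lookup-injective u)

isPerm≡isUnique : ∀ {n} (v : Vec (Fin n) n) → isPerm v ≡ isUnique v
isPerm≡isUnique v = T-⇔⇒≡ (mk⇔
  (λ t → Equivalence.from T-isUnique (Equivalence.to (Injective⇔Unique v) (isPerm⇒Injective v t)))
  (λ t → Injective⇒isPerm v (Equivalence.from (Injective⇔Unique v) (Equivalence.to T-isUnique t))))

Injective⇒surjective : ∀ {n} (v : Vec (Fin n) n) → Injective v → ∀ y → ∃ λ i → Vec.lookup v i ≡ y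
Injective⇒surjective {suc n} v inj y with any? (λ i → Vec.lookup v i ≟ y)
... | yes hit  = hit
... | no  miss with pigeonhole (ℕₚ.n<1+n n) (λ i → punchOut {i = y} {j = Vec.lookup v i} (miss ∘ (i ,_) ∘ sym))
... | i , j , i<j , same = ⊥-elim (Finₚ.<-irrefl vᵢ≡vⱼ⇒i≡j i<j)
  where
  vᵢ≡vⱼ⇒i≡j : i ≡ j
  vᵢ≡vⱼ⇒i≡j = inj i j (punchOut-injective (miss ∘ (i ,_) ∘ sym) (miss ∘ (j ,_) ∘ sym) same)

perm-surjective : ∀ {n} (u : Vec (Fin n) n) → T (isPerm u) → ∀ y → ∃ λ i → Vec.lookup u i ≡ y
perm-surjective u u-perm = Injective⇒surjective u (isPerm⇒Injective u u-perm)

count-perms-allVecs : ∀ {n} (P : Vec (Fin n) n → Bool) →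
                      count P (perms n) ≡ count (λ v → isUnique v ∧ P v) (allVecs n n)
count-perms-allVecs {n} P = trans (count-filterᵇ P isPerm (allVecs n n))
                                  (count-cong (λ v → cong (_∧ P v) (isPerm≡isUnique v)) (allVecs n n))

count-perms-cong : ∀ {n} {p q : Vec (Fin n) n → Bool} → (∀ v → T (isPerm v) → p v ≡ q v) →
                   count p (perms n) ≡ count q (perms n)
count-perms-cong {n} p≗q = count-filterᵇ-cong isPerm p≗q (allVecs n n)

count-perms-∷ : ∀ {n} {e : Fin (suc n) → Fin n → Fin (suc n)} → (∀ x → Skips x (e x)) → ∀ P →
                count P (perms (suc n)) ≡ ∑[ x < suc n ] count (λ u → P (x ∷ Vec.map (e x) u)) (perms n)
count-perms-∷ {n} {e} skips P = begin
  count P (perms (suc n))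
    ≡⟨ count-perms-allVecs P ⟩
  count (λ v → isUnique v ∧ P v) (allVecs (suc n) (suc n))
    ≡⟨ count-allVecs-∷ n (suc n) _ ⟩
  ∑[ x < suc n ] count (λ w → isUnique (x ∷ w) ∧ P (x ∷ w)) (allVecs n (suc n))
    ≡⟨ sum-cong-≗ {suc n} (λ x → count-allVecs-skipping (skips x) _
         (λ w x∈w → cong (_∧ P (x ∷ w)) (isUnique-false (¬Unique-∷ x∈w)))) ⟩
  ∑[ x < suc n ] count (λ u → isUnique (x ∷ Vec.map (e x) u) ∧ P (x ∷ Vec.map (e x) u)) (allVecs n n)
    ≡⟨ sum-cong-≗ {suc n} (λ x → count-cong (λ u → cong (_∧ P (x ∷ Vec.map (e x) u))
         (isUnique-cong (Unique-∷-skips (skips x) u))) (allVecs n n)) ⟩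
  ∑[ x < suc n ] count (λ u → isUnique u ∧ P (x ∷ Vec.map (e x) u)) (allVecs n n)
    ≡⟨ sum-cong-≗ {suc n} (λ x → count-perms-allVecs (λ u → P (x ∷ Vec.map (e x) u))) ⟨
  ∑[ x < suc n ] count (λ u → P (x ∷ Vec.map (e x) u)) (perms n)
    ∎
  where open ≡-Reasoning

count-perms-∷ʳ : ∀ {n} {e : Fin (suc n) → Fin n → Fin (suc n)} → (∀ x → Skips x (e x)) → ∀ P →
                 count P (perms (suc n)) ≡ ∑[ x < suc n ] count (λ u → P (Vec.map (e x) u ∷ʳ x)) (perms n)
count-perms-∷ʳ {n} {e} skips P = begin
  count P (perms (suc n))
    ≡⟨ count-perms-allVecs P ⟩
  count (λ v → isUnique v ∧ P v) (allVecs (suc n) (suc n))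
    ≡⟨ count-allVecs-∷ʳ n (suc n) _ ⟩
  ∑[ x < suc n ] count (λ w → isUnique (w ∷ʳ x) ∧ P (w ∷ʳ x)) (allVecs n (suc n))
    ≡⟨ sum-cong-≗ {suc n} (λ x → count-allVecs-skipping (skips x) _
         (λ w x∈w → cong (_∧ P (w ∷ʳ x)) (isUnique-false (¬Unique-∷ʳ x∈w)))) ⟩
  ∑[ x < suc n ] count (λ u → isUnique (Vec.map (e x) u ∷ʳ x) ∧ P (Vec.map (e x) u ∷ʳ x)) (allVecs n n)
    ≡⟨ sum-cong-≗ {suc n} (λ x → count-cong (λ u → cong (_∧ P (Vec.map (e x) u ∷ʳ x))
         (isUnique-cong (Unique-∷ʳ-skips (skips x) u))) (allVecs n n)) ⟩
  ∑[ x < suc n ] count (λ u → isUnique u ∧ P (Vec.map (e x) u ∷ʳ x)) (allVecs n n)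
    ≡⟨ sum-cong-≗ {suc n} (λ x → count-perms-allVecs (λ u → P (Vec.map (e x) u ∷ʳ x))) ⟨
  ∑[ x < suc n ] count (λ u → P (Vec.map (e x) u ∷ʳ x)) (perms n)
    ∎
  where open ≡-Reasoning

-- Statistics that grow under insertion

-- stirlingᵣ n k = c(n, n ∸ k)
stirlingᵣ : ℕ → ℕ → ℕ
stirlingᵣ zero    zero    = 1
stirlingᵣ zero    (suc k) = 0
stirlingᵣ (suc n) zero    = stirlingᵣ n zero
stirlingᵣ (suc n) (suc k) = stirlingᵣ n (suc k) + n * stirlingᵣ n k

Statistic : Set
Statistic = ∀ {n} → Vec (Fin n) n → ℕ

dist : Statistic → ℕ → ℕ → ℕ
dist stat n k = count (λ v → stat v ≡ᵇ k) (perms n)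

-- count-perms says that (x , u) ↦ insert x u is a bijection Fin (suc n) × Sₙ → Sₙ₊₁.
record Insertion (stat : Statistic) (n : ℕ) : Set where
  field
    insert       : Fin (suc n) → Vec (Fin n) n → Vec (Fin (suc n)) (suc n)
    count-perms  : ∀ P → count P (perms (suc n)) ≡ ∑[ x < suc n ] count (P ∘ insert x) (perms n)
    neutral      : Fin (suc n)
    others       : Fin n → Fin (suc n)
    skips        : Skips neutral others
    stat-neutral : ∀ u → T (isPerm u) → stat (insert neutral u) ≡ stat u
    stat-others  : ∀ z u → T (isPerm u) → stat (insert (others z) u) ≡ suc (stat u)

dist-suc : ∀ {stat : Statistic} {n} → Insertion stat n → ∀ k →
           dist stat (suc n) k ≡ dist stat n k + n * count (λ u → suc (stat u) ≡ᵇ k) (perms n)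
dist-suc {stat} {n} ins k = begin
  dist stat (suc n) k
    ≡⟨ count-perms (λ v → stat v ≡ᵇ k) ⟩
  ∑[ x < suc n ] count (λ u → stat (insert x u) ≡ᵇ k) (perms n)
    ≡⟨ Skips.∑-split skips (λ x → count (λ u → stat (insert x u) ≡ᵇ k) (perms n)) ⟩
  count (λ u → stat (insert neutral u) ≡ᵇ k) (perms n) +
  ∑[ z < n ] count (λ u → stat (insert (others z) u) ≡ᵇ k) (perms n)
    ≡⟨ cong₂ _+_ (count-perms-cong (λ u u-perm → cong (_≡ᵇ k) (stat-neutral u u-perm)))
                 (sum-cong-≗ {n} λ z → count-perms-cong (λ u u-perm → cong (_≡ᵇ k) (stat-others z u u-perm))) ⟩
  dist stat n k + ∑[ z < n ] count (λ u → suc (stat u) ≡ᵇ k) (perms n)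
    ≡⟨ cong (dist stat n k +_) (∑-const n _) ⟩
  dist stat n k + n * count (λ u → suc (stat u) ≡ᵇ k) (perms n)
    ∎
  where
  open ≡-Reasoning
  open Insertion ins

dist≡stirlingᵣ : ∀ {stat : Statistic} → stat [] ≡ 0 → (∀ n → Insertion stat n) →
                 ∀ n k → dist stat n k ≡ stirlingᵣ n k
dist≡stirlingᵣ {stat} stat[]≡0 ins zero k rewrite stat[]≡0 with k
... | zero  = refl
... | suc _ = refl
dist≡stirlingᵣ {stat} stat[]≡0 ins (suc n) zero = begin
  dist stat (suc n) 0                                ≡⟨ dist-suc (ins n) 0 ⟩
  dist stat n 0 + n * count (λ _ → false) (perms n)  ≡⟨ cong (λ c → dist stat n 0 + n * c)
                                                             (count-none (λ _ → refl) (perms n)) ⟩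
  dist stat n 0 + n * 0                              ≡⟨ cong (dist stat n 0 +_) (ℕₚ.*-zeroʳ n) ⟩
  dist stat n 0 + 0                                  ≡⟨ ℕₚ.+-identityʳ _ ⟩
  dist stat n 0                                      ≡⟨ dist≡stirlingᵣ stat[]≡0 ins n 0 ⟩
  stirlingᵣ n 0                                      ∎
  where open ≡-Reasoning
dist≡stirlingᵣ stat[]≡0 ins (suc n) (suc k) = trans (dist-suc (ins n) (suc k))
  (cong₂ (λ a b → a + n * b) (dist≡stirlingᵣ stat[]≡0 ins n (suc k)) (dist≡stirlingᵣ stat[]≡0 ins n k))

-- Right-to-left maxima and left-to-right minima

NonInversion : ∀ {m n} → Vec (Fin m) n → Fin n → Fin n → Set
NonInversion v i k = i Fin.< k × Vec.lookup v i Fin.< Vec.lookup v k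

nonInversion? : ∀ {m n} (v : Vec (Fin m) n) i k → Dec (NonInversion v i k)
nonInversion? v i k = i Fin.<? k ×-dec Vec.lookup v i Fin.<? Vec.lookup v k

nonRLmaxima : ∀ {m n} → Vec (Fin m) n → ℕ
nonRLmaxima {n = n} v = ∑[ i < n ] 𝟙 (does (any? (nonInversion? v i)))

nonLRminima : ∀ {m n} → Vec (Fin m) n → ℕ
nonLRminima {n = n} v = ∑[ k < n ] 𝟙 (does (any? (λ i → nonInversion? v i k)))

OrderEmbedding : ∀ {m m′} → (Fin m → Fin m′) → Set
OrderEmbedding f = ∀ a b → f a Fin.< f b ⇔ a Fin.< b

punchIn-orderEmbedding : ∀ {n} (x : Fin (suc n)) → OrderEmbedding (punchIn x)
punchIn-orderEmbedding x a b = mk⇔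
  (λ xa<xb → ℕₚ.≰⇒> (λ b≤a → ℕₚ.<⇒≱ xa<xb (punchIn-mono-≤ x b a b≤a)))
  (λ a<b → ℕₚ.≰⇒> (λ xb≤xa → ℕₚ.<⇒≱ a<b (punchIn-cancel-≤ x b a xb≤xa)))

module _ {m m′ n} {f : Fin m → Fin m′} (f-embedding : OrderEmbedding f) (u : Vec (Fin m) n) where

  NonInversion-map : ∀ i k → NonInversion (Vec.map f u) i k ⇔ NonInversion u i k
  NonInversion-map i k rewrite lookup-map i f u | lookup-map k f u = mk⇔
    (λ (i<k , fuᵢ<fuₖ) → i<k , Equivalence.to (f-embedding _ _) fuᵢ<fuₖ)
    (λ (i<k , uᵢ<uₖ) → i<k , Equivalence.from (f-embedding _ _) uᵢ<uₖ)

  nonRLmaxima-map : nonRLmaxima (Vec.map f u) ≡ nonRLmaxima u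
  nonRLmaxima-map = sum-cong-≗ {n} λ i → 𝟙-does-cong (∃-cong (NonInversion-map i))
    (any? (nonInversion? (Vec.map f u) i)) (any? (nonInversion? u i))

  nonLRminima-map : nonLRminima (Vec.map f u) ≡ nonLRminima u
  nonLRminima-map = sum-cong-≗ {n} λ k → 𝟙-does-cong (∃-cong (λ i → NonInversion-map i k))
    (any? (λ i → nonInversion? (Vec.map f u) i k)) (any? (λ i → nonInversion? u i k))

module _ {m n} (x : Fin m) (w : Vec (Fin m) n) where

  ∃-NonInversion-∷-head : ∃ (NonInversion (x ∷ w) fz) ⇔ ∃ (λ k → x Fin.< Vec.lookup w k)
  ∃-NonInversion-∷-head = mk⇔ (λ { (fs k , _ , x<wₖ) → k , x<wₖ }) (λ (k , x<wₖ) → fs k , z<s , x<wₖ)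

  ∃-NonInversion-∷-tail : ∀ i → ∃ (NonInversion (x ∷ w) (fs i)) ⇔ ∃ (NonInversion w i)
  ∃-NonInversion-∷-tail i = mk⇔ (λ { (fs k , i<k , wᵢ<wₖ) → k , s<s⁻¹ i<k , wᵢ<wₖ })
                                (λ (k , i<k , wᵢ<wₖ) → fs k , s<s i<k , wᵢ<wₖ)

  nonRLmaxima-∷ : nonRLmaxima (x ∷ w) ≡ 𝟙 (does (any? (λ k → x Fin.<? Vec.lookup w k))) + nonRLmaxima w
  nonRLmaxima-∷ = cong₂ _+_
    (𝟙-does-cong ∃-NonInversion-∷-head (any? (nonInversion? (x ∷ w) fz)) (any? (λ k → x Fin.<? Vec.lookup w k)))
    (sum-cong-≗ {n} λ i → 𝟙-does-cong (∃-NonInversion-∷-tail i)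
      (any? (nonInversion? (x ∷ w) (fs i))) (any? (nonInversion? w i)))

  nonRLmaxima-∷-maximum : (∀ k → ¬ x Fin.< Vec.lookup w k) → nonRLmaxima (x ∷ w) ≡ nonRLmaxima w
  nonRLmaxima-∷-maximum x-max =
    trans nonRLmaxima-∷ (cong (_+ nonRLmaxima w) (𝟙-no (λ (k , x<wₖ) → x-max k x<wₖ) (any? _)))

  nonRLmaxima-∷-smaller : ∀ k → x Fin.< Vec.lookup w k → nonRLmaxima (x ∷ w) ≡ suc (nonRLmaxima w)
  nonRLmaxima-∷-smaller k x<wₖ = trans nonRLmaxima-∷ (cong (_+ nonRLmaxima w) (𝟙-yes (k , x<wₖ) (any? _)))

module _ {A : Set} where

  lookup-∷ʳ-inject₁ : ∀ {n} (w : Vec A n) y i → Vec.lookup (w ∷ʳ y) (inject₁ i) ≡ Vec.lookup w i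
  lookup-∷ʳ-inject₁ (x ∷ w) y fz     = refl
  lookup-∷ʳ-inject₁ (x ∷ w) y (fs i) = lookup-∷ʳ-inject₁ w y i

  lookup-∷ʳ-last : ∀ {n} (w : Vec A n) y → Vec.lookup (w ∷ʳ y) (fromℕ n) ≡ y
  lookup-∷ʳ-last []      y = refl
  lookup-∷ʳ-last (x ∷ w) y = lookup-∷ʳ-last w y

last-or-inject₁ : ∀ {n} (i : Fin (suc n)) → i ≡ fromℕ n ⊎ ∃ λ j → i ≡ inject₁ j
last-or-inject₁ {zero}  fz     = inj₁ refl
last-or-inject₁ {suc n} fz     = inj₂ (fz , refl)
last-or-inject₁ {suc n} (fs i) with last-or-inject₁ i
... | inj₁ refl       = inj₁ refl
... | inj₂ (j , refl) = inj₂ (fs j , refl)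

inject₁-<-⇔ : ∀ {n} (i k : Fin n) → inject₁ i Fin.< inject₁ k ⇔ i Fin.< k
inject₁-<-⇔ i k rewrite toℕ-inject₁ i | toℕ-inject₁ k = mk⇔ (λ i<k → i<k) (λ i<k → i<k)

inject₁<fromℕ : ∀ {n} (i : Fin n) → inject₁ i Fin.< fromℕ n
inject₁<fromℕ {n} i rewrite toℕ-inject₁ i | toℕ-fromℕ n = toℕ<n i

inject₁<suc : ∀ {n} (z : Fin n) → inject₁ z Fin.< fs z
inject₁<suc z rewrite toℕ-inject₁ z = ℕₚ.n<1+n (toℕ z)

module _ {m n} (w : Vec (Fin m) n) (y : Fin m) where

  NonInversion-∷ʳ : ∀ i k → NonInversion (w ∷ʳ y) (inject₁ i) (inject₁ k) ⇔ NonInversion w i k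
  NonInversion-∷ʳ i k rewrite lookup-∷ʳ-inject₁ w y i | lookup-∷ʳ-inject₁ w y k = mk⇔
    (λ (i<k , wᵢ<wₖ) → Equivalence.to (inject₁-<-⇔ i k) i<k , wᵢ<wₖ)
    (λ (i<k , wᵢ<wₖ) → Equivalence.from (inject₁-<-⇔ i k) i<k , wᵢ<wₖ)

  ∃-NonInversion-∷ʳ-init : ∀ k → ∃ (λ i → NonInversion (w ∷ʳ y) i (inject₁ k)) ⇔
                                 ∃ (λ i → NonInversion w i k)
  ∃-NonInversion-∷ʳ-init k = mk⇔ to (λ (i , inv) → inject₁ i , Equivalence.from (NonInversion-∷ʳ i k) inv)
    where
    to : ∃ (λ i → NonInversion (w ∷ʳ y) i (inject₁ k)) → ∃ (λ i → NonInversion w i k)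
    to (i , inv) with last-or-inject₁ i
    ... | inj₁ refl       = ⊥-elim (ℕₚ.<-asym (inject₁<fromℕ k) (proj₁ inv))
    ... | inj₂ (j , refl) = j , Equivalence.to (NonInversion-∷ʳ j k) inv

  ∃-NonInversion-∷ʳ-last : ∃ (λ i → NonInversion (w ∷ʳ y) i (fromℕ n)) ⇔
                           ∃ (λ i → Vec.lookup w i Fin.< y)
  ∃-NonInversion-∷ʳ-last = mk⇔ to from
    where
    to : ∃ (λ i → NonInversion (w ∷ʳ y) i (fromℕ n)) → ∃ (λ i → Vec.lookup w i Fin.< y)
    to (i , inv) with last-or-inject₁ i
    ... | inj₁ refl       = ⊥-elim (ℕₚ.<-irrefl refl (proj₁ inv))
    ... | inj₂ (j , refl) = j , subst₂ Fin._<_ (lookup-∷ʳ-inject₁ w y j) (lookup-∷ʳ-last w y) (proj₂ inv)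
    from : ∃ (λ i → Vec.lookup w i Fin.< y) → ∃ (λ i → NonInversion (w ∷ʳ y) i (fromℕ n))
    from (i , wᵢ<y) = inject₁ i , inject₁<fromℕ i ,
                      subst₂ Fin._<_ (sym (lookup-∷ʳ-inject₁ w y i)) (sym (lookup-∷ʳ-last w y)) wᵢ<y

  nonLRminima-∷ʳ : nonLRminima (w ∷ʳ y) ≡ nonLRminima w + 𝟙 (does (any? (λ i → Vec.lookup w i Fin.<? y)))
  nonLRminima-∷ʳ = trans (sum-init-last {n} (λ k → 𝟙 (does (any? (λ i → nonInversion? (w ∷ʳ y) i k)))))
    (cong₂ _+_
      (sum-cong-≗ {n} λ k → 𝟙-does-cong (∃-NonInversion-∷ʳ-init k)
        (any? (λ i → nonInversion? (w ∷ʳ y) i (inject₁ k))) (any? (λ i → nonInversion? w i k)))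
      (𝟙-does-cong ∃-NonInversion-∷ʳ-last
        (any? (λ i → nonInversion? (w ∷ʳ y) i (fromℕ n))) (any? (λ i → Vec.lookup w i Fin.<? y))))

  nonLRminima-∷ʳ-minimum : (∀ i → ¬ Vec.lookup w i Fin.< y) → nonLRminima (w ∷ʳ y) ≡ nonLRminima w
  nonLRminima-∷ʳ-minimum y-min = trans nonLRminima-∷ʳ
    (trans (cong (nonLRminima w +_) (𝟙-no (λ (i , wᵢ<y) → y-min i wᵢ<y) (any? _))) (ℕₚ.+-identityʳ _))

  nonLRminima-∷ʳ-larger : ∀ i → Vec.lookup w i Fin.< y → nonLRminima (w ∷ʳ y) ≡ suc (nonLRminima w)
  nonLRminima-∷ʳ-larger i wᵢ<y = trans nonLRminima-∷ʳ
    (trans (cong (nonLRminima w +_) (𝟙-yes (i , wᵢ<y) (any? _))) (ℕₚ.+-comm _ 1))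

punchIn-inject₁-self : ∀ {n} (z : Fin n) → punchIn (inject₁ z) z ≡ fs z
punchIn-inject₁-self fz     = refl
punchIn-inject₁-self (fs z) = cong fs (punchIn-inject₁-self z)

punchIn-suc-self : ∀ {n} (z : Fin n) → punchIn (fs z) z ≡ inject₁ z
punchIn-suc-self fz     = refl
punchIn-suc-self (fs z) = cong fs (punchIn-suc-self z)

lookup-map-preimage : ∀ {m m′ n} (f : Fin m → Fin m′) (u : Vec (Fin m) n) {k z} →
                      Vec.lookup u k ≡ z → Vec.lookup (Vec.map f u) k ≡ f z
lookup-map-preimage f u {k} uₖ≡z = trans (lookup-map k f u) (cong f uₖ≡z)

nonRLmaxima-insertion : ∀ n → Insertion nonRLmaxima n
nonRLmaxima-insertion n = record
  { insert       = λ x u → x ∷ Vec.map (punchIn x) u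
  ; count-perms  = count-perms-∷ punchIn-skips
  ; neutral      = fromℕ n
  ; others       = inject₁
  ; skips        = inject₁-skips
  ; stat-neutral = λ u _ → trans
      (nonRLmaxima-∷-maximum (fromℕ n) (Vec.map (punchIn (fromℕ n)) u)
                             (λ k top< → ℕₚ.<⇒≱ top< (≤fromℕ _)))
      (nonRLmaxima-map (punchIn-orderEmbedding (fromℕ n)) u)
  ; stat-others  = stat-other
  }
  where
  stat-other : ∀ z u → T (isPerm u) →
               nonRLmaxima (inject₁ z ∷ Vec.map (punchIn (inject₁ z)) u) ≡ suc (nonRLmaxima u)
  stat-other z u u-perm with perm-surjective u u-perm z
  ... | k , uₖ≡z = trans
    (nonRLmaxima-∷-smaller (inject₁ z) (Vec.map (punchIn (inject₁ z)) u) k inject₁z<uₖ′)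
    (cong suc (nonRLmaxima-map (punchIn-orderEmbedding (inject₁ z)) u))
    where
    inject₁z<uₖ′ : inject₁ z Fin.< Vec.lookup (Vec.map (punchIn (inject₁ z)) u) k
    inject₁z<uₖ′ = subst (inject₁ z Fin.<_)
      (sym (trans (lookup-map-preimage (punchIn (inject₁ z)) u uₖ≡z) (punchIn-inject₁-self z))) (inject₁<suc z)

nonLRminima-insertion : ∀ n → Insertion nonLRminima n
nonLRminima-insertion n = record
  { insert       = λ y u → Vec.map (punchIn y) u ∷ʳ y
  ; count-perms  = count-perms-∷ʳ punchIn-skips
  ; neutral      = fz
  ; others       = fs
  ; skips        = punchIn-skips fz
  ; stat-neutral = λ u _ → trans (nonLRminima-∷ʳ-minimum (Vec.map (punchIn fz) u) fz (λ _ ()))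
                                 (nonLRminima-map (punchIn-orderEmbedding fz) u)
  ; stat-others  = stat-other
  }
  where
  stat-other : ∀ z u → T (isPerm u) → nonLRminima (Vec.map (punchIn (fs z)) u ∷ʳ fs z) ≡ suc (nonLRminima u)
  stat-other z u u-perm with perm-surjective u u-perm z
  ... | i , uᵢ≡z = trans (nonLRminima-∷ʳ-larger (Vec.map (punchIn (fs z)) u) (fs z) i uᵢ′<suc-z)
                         (cong suc (nonLRminima-map (punchIn-orderEmbedding (fs z)) u))
    where
    uᵢ′<suc-z : Vec.lookup (Vec.map (punchIn (fs z)) u) i Fin.< fs z
    uᵢ′<suc-z = subst (Fin._< fs z)
      (sym (trans (lookup-map-preimage (punchIn (fs z)) u uᵢ≡z) (punchIn-suc-self z))) (inject₁<suc z)

-- Cycles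

iter-+ : ∀ {n} (v : Vec (Fin n) n) s t i → iter v (s + t) i ≡ iter v s (iter v t i)
iter-+ v zero    t i = refl
iter-+ v (suc s) t i = cong (Vec.lookup v) (iter-+ v s t i)

-- Pigeonhole gives iter α = iter β with α < β ≤ n; beyond β the orbit repeats with period β ∸ α.
iter-bounded : ∀ {n} (v : Vec (Fin n) n) i t → ∃ λ s → s < n × iter v t i ≡ iter v s i
iter-bounded {n} v i with pigeonhole (ℕₚ.n<1+n n) (λ a → iter v (toℕ a) i)
... | a , b , a<b , same = <-rec _ reduce
  where
  α β : ℕ
  α = toℕ a
  β = toℕ b
  reduce : ∀ t → (∀ {t′} → t′ < t → ∃ λ s → s < n × iter v t′ i ≡ iter v s i) →
           ∃ λ s → s < n × iter v t i ≡ iter v s i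
  reduce t earlier with t <? β
  ... | yes t<β = t , ℕₚ.≤-trans t<β (ℕₚ.≤-pred (toℕ<n b)) , refl
  ... | no  t≮β
    with earlier {t ∸ β + α}
                 (subst (t ∸ β + α <_) (ℕₚ.m∸n+n≡m (ℕₚ.≮⇒≥ t≮β)) (ℕₚ.+-monoʳ-< (t ∸ β) a<b))
  ...   | s , s<n , iter≡ = s , s<n , (begin
    iter v t i                   ≡⟨ cong (λ t → iter v t i) (ℕₚ.m∸n+n≡m (ℕₚ.≮⇒≥ t≮β)) ⟨
    iter v (t ∸ β + β) i         ≡⟨ iter-+ v (t ∸ β) β i ⟩
    iter v (t ∸ β) (iter v β i)  ≡⟨ cong (iter v (t ∸ β)) same ⟨
    iter v (t ∸ β) (iter v α i)  ≡⟨ iter-+ v (t ∸ β) α i ⟨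
    iter v (t ∸ β + α) i         ≡⟨ iter≡ ⟩
    iter v s i                   ∎)
    where open ≡-Reasoning

isLeader : ∀ {n} → Vec (Fin n) n → Fin n → Bool
isLeader {n} v i = all (λ t → toℕ i ≤ᵇ toℕ (iter v t i)) (upTo n)

Leader : ∀ {n} → Vec (Fin n) n → Fin n → Set
Leader v i = ∀ t → i Fin.≤ iter v t i

T-isLeader : ∀ {n} (v : Vec (Fin n) n) i → T (isLeader v i) ⇔ Leader v i
T-isLeader {n} v i = mk⇔
  (λ leader t → let (s , s<n , iter≡) = iter-bounded v i t in
     subst (i Fin.≤_) (sym iter≡) (ℕₚ.≤ᵇ⇒≤ _ _ (to (T-all-applyUpTo n _ (λ t → t)) leader s s<n)))
  (λ leader → from (T-all-applyUpTo n _ (λ t → t)) (λ t _ → ℕₚ.≤⇒≤ᵇ (leader t)))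
  where open Equivalence

nonLeaders : Statistic
nonLeaders {n} v = ∑[ i < n ] 𝟙 (not (isLeader v i))

-- π follows the orbits of u, except that a step z ↦ u z may make a detour through the new element n.
module Detour {n} (π : Vec (Fin (suc n)) (suc n)) (u : Vec (Fin n) n)
  (step : ∀ z → Vec.lookup π (inject₁ z) ≡ inject₁ (Vec.lookup u z)
              ⊎ (Vec.lookup π (inject₁ z) ≡ fromℕ n × Vec.lookup π (fromℕ n) ≡ inject₁ (Vec.lookup u z))) where

  Position : Fin n → ℕ → ℕ → Set
  Position i t s = iter π t (inject₁ i) ≡ inject₁ (iter u s i)
                 ⊎ (iter π t (inject₁ i) ≡ fromℕ n × Vec.lookup π (fromℕ n) ≡ inject₁ (iter u (suc s) i))

  orbit-covered : ∀ i t → ∃ (Position i t)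
  orbit-covered i zero = 0 , inj₁ refl
  orbit-covered i (suc t) with orbit-covered i t
  ... | s , inj₂ (at-n , next) = suc s , inj₁ (trans (cong (Vec.lookup π) at-n) next)
  ... | s , inj₁ at with step (iter u s i)
  ...   | inj₁ direct        = suc s , inj₁ (trans (cong (Vec.lookup π) at) direct)
  ...   | inj₂ (to-n , next) = s , inj₂ (trans (cong (Vec.lookup π) at) to-n , next)

  orbit-reached : ∀ i s → ∃ λ t → iter π t (inject₁ i) ≡ inject₁ (iter u s i)
  orbit-reached i zero = 0 , refl
  orbit-reached i (suc s) with orbit-reached i s
  ... | t , at with step (iter u s i)
  ...   | inj₁ direct        = suc t , trans (cong (Vec.lookup π) at) direct
  ...   | inj₂ (to-n , next) =
    suc (suc t) , trans (cong (Vec.lookup π) (trans (cong (Vec.lookup π) at) to-n)) next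

  Leader-inject₁ : ∀ i → Leader π (inject₁ i) ⇔ Leader u i
  Leader-inject₁ i = mk⇔
    (λ leader s → let (t , at) = orbit-reached i s in
       subst₂ _≤_ (toℕ-inject₁ i) (trans (cong toℕ at) (toℕ-inject₁ _)) (leader t))
    (λ leader t → above t (orbit-covered i t) leader)
    where
    above : ∀ t → ∃ (Position i t) → Leader u i → inject₁ i Fin.≤ iter π t (inject₁ i)
    above t (s , inj₁ at) leader =
      subst₂ _≤_ (sym (toℕ-inject₁ i)) (sym (trans (cong toℕ at) (toℕ-inject₁ _))) (leader s)
    above t (s , inj₂ (at-n , _)) _ = subst (inject₁ i Fin.≤_) (sym at-n) (≤fromℕ (inject₁ i))

  nonLeaders-detour : nonLeaders π ≡ nonLeaders u + 𝟙 (not (isLeader π (fromℕ n)))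
  nonLeaders-detour = trans (sum-init-last {n} (λ i → 𝟙 (not (isLeader π i))))
    (cong (_+ 𝟙 (not (isLeader π (fromℕ n)))) (sum-cong-≗ {n} λ i → cong (𝟙 ∘ not)
      (T-⇔⇒≡ (⇔-sym (T-isLeader u i) ⇔-∘ (Leader-inject₁ i ⇔-∘ T-isLeader π (inject₁ i))))))

  nonLeaders-top-leader : Leader π (fromℕ n) → nonLeaders π ≡ nonLeaders u
  nonLeaders-top-leader leader = trans nonLeaders-detour (trans (cong (nonLeaders u +_)
    (𝟙-false (λ t → Equivalence.to T-not t (Equivalence.from (T-isLeader π (fromℕ n)) leader))))
    (ℕₚ.+-identityʳ _))

  nonLeaders-top-not-leader : ¬ Leader π (fromℕ n) → nonLeaders π ≡ suc (nonLeaders u)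
  nonLeaders-top-not-leader ¬leader = trans nonLeaders-detour (trans (cong (nonLeaders u +_)
    (𝟙-true (Equivalence.from T-not (¬leader ∘ Equivalence.to (T-isLeader π (fromℕ n))))))
    (ℕₚ.+-comm _ 1))

relabel-top : ∀ {n} (z : Fin n) → relabel (fromℕ n) z ≡ inject₁ z
relabel-top {n} z
  rewrite dec-false (inject₁ z ≟ fromℕ n) (fromℕ≢inject₁ ∘ sym)
        | dec-false (inject₁ z ≟ fromℕ n) (fromℕ≢inject₁ ∘ sym) = refl

relabel-self : ∀ {n} (y : Fin n) → relabel (inject₁ y) y ≡ fromℕ n
relabel-self y rewrite dec-true (inject₁ y ≟ inject₁ y) refl = refl

relabel-other : ∀ {n} {y z : Fin n} → z ≢ y → relabel (inject₁ y) z ≡ inject₁ z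
relabel-other {n} {y} {z} z≢y
  rewrite dec-false (inject₁ z ≟ inject₁ y) (z≢y ∘ inject₁-injective)
        | dec-false (inject₁ z ≟ fromℕ n) (fromℕ≢inject₁ ∘ sym) = refl

nonLeaders-insertion : ∀ n → Insertion nonLeaders n
nonLeaders-insertion n = record
  { insert       = insert
  ; count-perms  = count-perms-∷ʳ relabel-skips
  ; neutral      = fromℕ n
  ; others       = inject₁
  ; skips        = inject₁-skips
  ; stat-neutral = λ u _ → stat-top u
  ; stat-others  = λ y u _ → stat-other y u
  }
  where
  insert : Fin (suc n) → Vec (Fin n) n → Vec (Fin (suc n)) (suc n)
  insert x u = Vec.map (relabel x) u ∷ʳ x

  lookup-insert : ∀ x u z → Vec.lookup (insert x u) (inject₁ z) ≡ relabel x (Vec.lookup u z)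
  lookup-insert x u z = trans (lookup-∷ʳ-inject₁ (Vec.map (relabel x) u) x z) (lookup-map z (relabel x) u)

  lookup-insert-top : ∀ x u → Vec.lookup (insert x u) (fromℕ n) ≡ x
  lookup-insert-top x u = lookup-∷ʳ-last (Vec.map (relabel x) u) x

  stat-top : ∀ u → nonLeaders (insert (fromℕ n) u) ≡ nonLeaders u
  stat-top u = Detour.nonLeaders-top-leader π u
    (λ z → inj₁ (trans (lookup-insert (fromℕ n) u z) (relabel-top _)))
    (λ t → subst (fromℕ n Fin.≤_) (sym (top-fixed t)) ℕₚ.≤-refl)
    where
    π = insert (fromℕ n) u
    top-fixed : ∀ t → iter π t (fromℕ n) ≡ fromℕ n
    top-fixed zero    = refl
    top-fixed (suc t) = trans (cong (Vec.lookup π) (top-fixed t)) (lookup-insert-top (fromℕ n) u)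

  stat-other : ∀ y u → nonLeaders (insert (inject₁ y) u) ≡ suc (nonLeaders u)
  stat-other y u = Detour.nonLeaders-top-not-leader π u step
    (λ leader → ℕₚ.<⇒≱ (inject₁<fromℕ y)
                         (subst (fromℕ n Fin.≤_) (lookup-insert-top (inject₁ y) u) (leader 1)))
    where
    π = insert (inject₁ y) u
    step : ∀ z → Vec.lookup π (inject₁ z) ≡ inject₁ (Vec.lookup u z)
               ⊎ (Vec.lookup π (inject₁ z) ≡ fromℕ n × Vec.lookup π (fromℕ n) ≡ inject₁ (Vec.lookup u z))
    step z with Vec.lookup u z ≟ y
    ... | yes uz≡y = inj₂
      ( trans (lookup-insert (inject₁ y) u z) (trans (cong (relabel (inject₁ y)) uz≡y) (relabel-self y))
      , trans (lookup-insert-top (inject₁ y) u) (cong inject₁ (sym uz≡y)) )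
    ... | no  uz≢y = inj₁ (trans (lookup-insert (inject₁ y) u z) (relabel-other uz≢y))

cycles≡leaders : ∀ {n} (v : Vec (Fin n) n) → cycles v ≡ ∑[ i < n ] 𝟙 (isLeader v i)
cycles≡leaders v = count-tabulate (isLeader v) (λ i → i)

cycles+nonLeaders : ∀ {n} (v : Vec (Fin n) n) → cycles v + nonLeaders v ≡ n
cycles+nonLeaders {n} v = begin
  cycles v + nonLeaders v
    ≡⟨ cong (_+ nonLeaders v) (cycles≡leaders v) ⟩
  ∑[ i < n ] 𝟙 (isLeader v i) + ∑[ i < n ] 𝟙 (not (isLeader v i))
    ≡⟨ ∑-distrib-+ (𝟙 ∘ isLeader v) (𝟙 ∘ not ∘ isLeader v) ⟨
  ∑[ i < n ] (𝟙 (isLeader v i) + 𝟙 (not (isLeader v i)))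
    ≡⟨ sum-cong-≗ {n} (𝟙-+-not ∘ isLeader v) ⟩
  ∑[ i < n ] 1
    ≡⟨ ∑-const n 1 ⟩
  n * 1
    ≡⟨ ℕₚ.*-identityʳ n ⟩
  n
    ∎
  where open ≡-Reasoning

complement-≡ : ∀ {c l n k} → c + l ≡ n → k ≤ n → c ≡ n ∸ k ⇔ l ≡ k
complement-≡ {c} {l} c+l≡n k≤n = mk⇔
  (λ c≡n∸k → trans (sym (ℕₚ.m+n∸m≡n c l))
                    (trans (cong₂ _∸_ c+l≡n c≡n∸k) (ℕₚ.m∸[m∸n]≡n k≤n)))
  (λ l≡k → trans (sym (ℕₚ.m+n∸n≡m c l)) (cong₂ _∸_ c+l≡n l≡k))

≡ᵇ-cong : ∀ {a b c d} → a ≡ b ⇔ c ≡ d → (a ≡ᵇ b) ≡ (c ≡ᵇ d)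
≡ᵇ-cong {a} {b} {c} {d} a≡b⇔c≡d = T-⇔⇒≡ (mk⇔
  (λ t → ℕₚ.≡⇒≡ᵇ c d (Equivalence.to a≡b⇔c≡d (ℕₚ.≡ᵇ⇒≡ a b t)))
  (λ t → ℕₚ.≡⇒≡ᵇ a b (Equivalence.from a≡b⇔c≡d (ℕₚ.≡ᵇ⇒≡ c d t))))

stirling1≡dist-nonLeaders : ∀ {n k} → k ≤ n → stirling1 n (n ∸ k) ≡ dist nonLeaders n k
stirling1≡dist-nonLeaders {n} {k} k≤n = count-perms-cong λ v _ →
  ≡ᵇ-cong {cycles v} {n ∸ k} {nonLeaders v} {k} (complement-≡ (cycles+nonLeaders v) k≤n)

-- Occurrences of the eight patterns

module Extremum {_⊑_ : ℕ → ℕ → Set} (⊑-isTotalOrder : IsTotalOrder _≡_ _⊑_) where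
  open IsTotalOrder ⊑-isTotalOrder using (total; antisym) renaming (refl to ⊑-refl; trans to ⊑-trans)

  IsExtremum : ∀ {n} → (Fin n → ℕ) → (Fin n → Set) → Fin n → Set
  IsExtremum key P j = P j × (∀ k → P k → key k ⊑ key j)

  extremum-exists : ∀ {n} {P : Fin n → Set} → Decidable P → (key : Fin n → ℕ) →
                    ∃ P → ∃ (IsExtremum key P)
  extremum-exists {suc n} {P} P? key (k₀ , pk₀) with any? (P? ∘ fs)
  ... | no none = fz , p₀ k₀ pk₀ , λ { fz _ → ⊑-refl ; (fs k) pk → ⊥-elim (none (k , pk)) }
    where
    p₀ : ∀ k → P k → P fz
    p₀ fz     pk = pk
    p₀ (fs k) pk = ⊥-elim (none (k , pk))
  ... | yes some with extremum-exists (P? ∘ fs) (key ∘ fs) some | P? fz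
  ...   | j , pj , j-ext | no ¬p₀ = fs j , pj , λ { fz p₀ → ⊥-elim (¬p₀ p₀) ; (fs k) pk → j-ext k pk }
  ...   | j , pj , j-ext | yes p₀ with total (key fz) (key (fs j))
  ...     | inj₁ 0⊑j = fs j , pj , λ { fz _ → 0⊑j ; (fs k) pk → j-ext k pk }
  ...     | inj₂ j⊑0 = fz , p₀ , λ { fz _ → ⊑-refl ; (fs k) pk → ⊑-trans (j-ext k pk) j⊑0 }

  extremum-unique : ∀ {n} {key : Fin n → ℕ} {P} → (∀ {a b} → key a ≡ key b → a ≡ b) →
                    ∀ {a b} → IsExtremum key P a → IsExtremum key P b → a ≡ b
  extremum-unique key-injective (pa , a-ext) (pb , b-ext) =
    key-injective (antisym (b-ext _ pa) (a-ext _ pb))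

  ∑-𝟙-extremum : ∀ {n} {key : Fin n → ℕ} {P} → (∀ {a b} → key a ≡ key b → a ≡ b) →
                 (P? : Decidable P) →
                 (O : Fin n → Bool) → (∀ j → T (O j) ⇔ IsExtremum key P j) →
                 ∑[ j < n ] 𝟙 (O j) ≡ 𝟙 (does (any? P?))
  ∑-𝟙-extremum {n} {key} key-injective P? O O⇔extremum with any? P?
  ... | no none = ∑-zero (λ j → 𝟙-false (λ oj → none (j , proj₁ (Equivalence.to (O⇔extremum j) oj))))
  ... | yes some with extremum-exists P? key some
  ...   | j , j-extremum = ∑-𝟙-unique j (Equivalence.from (O⇔extremum j) j-extremum)
      (λ k ok → extremum-unique key-injective (Equivalence.to (O⇔extremum k) ok) j-extremum)

open TotalOrderProperties ℕₚ.≤-totalOrder using (≥-isTotalOrder)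

module Max = Extremum ℕₚ.≤-isTotalOrder
module Min = Extremum ≥-isTotalOrder

module _ {n} {P : Fin n → Set} {key : Fin n → ℕ} {e : Fin n} where

  no-larger⇔maximum : (P e × (∀ k → ¬ (P k × key e < key k))) ⇔ Max.IsExtremum key P e
  no-larger⇔maximum = mk⇔ (λ (pe , none) → pe , λ k pk → ℕₚ.≮⇒≥ (λ lt → none k (pk , lt)))
                          (λ (pe , max) → pe , λ k (pk , lt) → ℕₚ.<⇒≱ lt (max k pk))

  no-smaller⇔minimum : (P e × (∀ k → ¬ (P k × key k < key e))) ⇔ Min.IsExtremum key P e
  no-smaller⇔minimum = mk⇔ (λ (pe , none) → pe , λ k pk → ℕₚ.≮⇒≥ (λ lt → none k (pk , lt)))
                           (λ (pe , min) → pe , λ k (pk , lt) → ℕₚ.<⇒≱ lt (min k pk))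

by-comparing : ∀ {D : Set} x y → (x < y → D) → (x ≡ y → D) → (y < x → D) → D
by-comparing x y lt eq gt with ℕₚ.<-cmp x y
... | tri< x<y _ _ = lt x<y
... | tri≈ _ x≡y _ = eq x≡y
... | tri> _ _ y<x = gt y<x

-- The two shaded boxes, together with e itself, contain exactly the candidates that beat e
-- (the set Q); so both boxes are empty iff nothing beats e.
record Cover {n} (A B Q : Fin n → Set) (e : Fin n) : Set where
  field
    A⊆Q     : ∀ {k} → A k → Q k
    B⊆Q     : ∀ {k} → B k → Q k
    Q⊆A∪B∪e : ∀ {k} → Q k → A k ⊎ B k ⊎ k ≡ e
    e∉Q     : ¬ Q e

  empty⇔ : ((∀ k → ¬ A k) × (∀ k → ¬ B k)) ⇔ (∀ k → ¬ Q k)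
  empty⇔ = mk⇔
    (λ (¬A , ¬B) k q → case (Q⊆A∪B∪e q) ¬A ¬B q)
    (λ ¬Q → (λ k a → ¬Q k (A⊆Q a)) , (λ k b → ¬Q k (B⊆Q b)))
    where
    case : ∀ {k} → A k ⊎ B k ⊎ k ≡ e → (∀ k → ¬ A k) → (∀ k → ¬ B k) → ¬ Q k
    case (inj₁ a)           ¬A _  _ = ¬A _ a
    case (inj₂ (inj₁ b))    _  ¬B _ = ¬B _ b
    case (inj₂ (inj₂ refl)) _  _  q = e∉Q q

occ-as-sum : ∀ {n} R (v : Vec (Fin n) n) → occ R v ≡ ∑[ i < n ] ∑[ j < n ] 𝟙 (isOcc R v i j)
occ-as-sum {n} R v = trans (length-concatMap-tabulate (λ i → filterᵇ (isOcc R v i) (allFin n)) (λ i → i))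
                           (sum-cong-≗ {n} (λ i → count-tabulate (isOcc R v i) (λ j → j)))

module Mesh {n} (v : Vec (Fin n) n) (v-injective : Injective v) where

  _≺_ : Fin n → Fin n → Set
  i ≺ k = pos i < pos k × val v i < val v k

  _≺?_ : ∀ i k → Dec (i ≺ k)
  i ≺? k = pos i <? pos k ×-dec val v i <? val v k

  ≺⇔NonInversion : ∀ i k → i ≺ k ⇔ NonInversion v i k
  ≺⇔NonInversion i k = mk⇔ (λ (p , q) → s<s⁻¹ p , s<s⁻¹ q) (λ (p , q) → s<s p , s<s q)

  pos-injective : ∀ {a b : Fin n} → pos a ≡ pos b → a ≡ b
  pos-injective pa≡pb = toℕ-injective (ℕₚ.suc-injective pa≡pb)

  val-injective : ∀ {a b : Fin n} → val v a ≡ val v b → a ≡ b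
  val-injective {a} {b} va≡vb = v-injective a b (toℕ-injective (ℕₚ.suc-injective va≡vb))

  0<pos : ∀ (k : Fin n) → 0 < pos k
  0<pos k = z<s

  0<val : ∀ (k : Fin n) → 0 < val v k
  0<val k = z<s

  pos<top : ∀ (k : Fin n) → pos k < suc n
  pos<top k = s<s (toℕ<n k)

  val<top : ∀ (k : Fin n) → val v k < suc n
  val<top k = s<s (toℕ<n (Vec.lookup v k))

  InBox : Fin n → Fin n → Fin 3 × Fin 3 → Fin n → Set
  InBox i j (a , b) k =
    grid (pos i) (pos j) n (inject₁ a) < pos k × pos k < grid (pos i) (pos j) n (fs a) ×
    grid (val v i) (val v j) n (inject₁ b) < val v k × val v k < grid (val v i) (val v j) n (fs b)

  T-inBox : ∀ i j box k → T (inBox v i j box k) ⇔ InBox i j box k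
  T-inBox i j box k = mk⇔
    (λ t → let (t₁ , t₂₃₄) = to T-∧ t ; (t₂ , t₃₄) = to T-∧ t₂₃₄ ; (t₃ , t₄) = to T-∧ t₃₄ in
       to T-<ᵇ t₁ , to T-<ᵇ t₂ , to T-<ᵇ t₃ , to T-<ᵇ t₄)
    (λ (p₁ , p₂ , p₃ , p₄) →
       from T-∧ (from T-<ᵇ p₁ , from T-∧ (from T-<ᵇ p₂ , from T-∧ (from T-<ᵇ p₃ , from T-<ᵇ p₄))))
    where open Equivalence

  T-noneInBox : ∀ i j box → T (not (any (inBox v i j box) (allFin n))) ⇔ (∀ k → ¬ InBox i j box k)
  T-noneInBox i j box = mk⇔
    (λ t k → to (T-none _ (λ k → k)) t k ∘ from (T-inBox i j box k))
    (λ none → from (T-none _ (λ k → k)) (λ k → none k ∘ to (T-inBox i j box k)))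
    where open Equivalence

  T-isOcc₂ : ∀ b₁ b₂ i j → T (isOcc (b₁ ∷ b₂ ∷ []) v i j) ⇔
                            (i ≺ j × (∀ k → ¬ InBox i j b₁ k) × (∀ k → ¬ InBox i j b₂ k))
  T-isOcc₂ b₁ b₂ i j = mk⇔
    (λ t → let (t₁ , t₂₃₄) = to T-∧ t ; (t₂ , t₃₄) = to T-∧ t₂₃₄
               (t₃ , t₄⊤) = to T-∧ t₃₄ ; (t₄ , _) = to T-∧ t₄⊤ in
       (to T-<ᵇ t₁ , to T-<ᵇ t₂) , to (T-noneInBox i j b₁) t₃ , to (T-noneInBox i j b₂) t₄)
    (λ ((p₁ , p₂) , e₁ , e₂) → from T-∧ (from T-<ᵇ p₁ , from T-∧ (from T-<ᵇ p₂ ,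
       from T-∧ (from (T-noneInBox i j b₁) e₁ , from T-∧ (from (T-noneInBox i j b₂) e₂ , _)))))
    where open Equivalence

  occurrence⇔ : ∀ b₁ b₂ {i j e} {Q : Fin n → Set} → (i ≺ j → Cover (InBox i j b₁) (InBox i j b₂) Q e) →
                T (isOcc (b₁ ∷ b₂ ∷ []) v i j) ⇔ (i ≺ j × (∀ k → ¬ Q k))
  occurrence⇔ b₁ b₂ {i} {j} cover = mk⇔
    (λ t → let (i≺j , empty) = split (to (T-isOcc₂ b₁ b₂ i j) t) in
       i≺j , to (Cover.empty⇔ (cover i≺j)) empty)
    (λ (i≺j , none) → from (T-isOcc₂ b₁ b₂ i j) (i≺j , from (Cover.empty⇔ (cover i≺j)) none))
    where
    open Equivalence
    split : ∀ {X Y Z : Set} → X × Y × Z → X × (Y × Z)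
    split (x , y , z) = x , y , z

  occurrence-R₁ : ∀ i j → T (isOcc R₁ v i j) ⇔ Max.IsExtremum (val v) (i ≺_) j
  occurrence-R₁ i j = no-larger⇔maximum ⇔-∘ occurrence⇔ (f1 , f2) (f2 , f2) λ (pᵢⱼ , vᵢⱼ) → record
    { A⊆Q     = λ (pᵢₖ , _ , vⱼₖ , _) → (pᵢₖ , ℕₚ.<-trans vᵢⱼ vⱼₖ) , vⱼₖ
    ; B⊆Q     = λ (pⱼₖ , _ , vⱼₖ , _) → (ℕₚ.<-trans pᵢⱼ pⱼₖ , ℕₚ.<-trans vᵢⱼ vⱼₖ) , vⱼₖ
    ; Q⊆A∪B∪e = λ { {k} ((pᵢₖ , _) , vⱼₖ) → by-comparing (pos k) (pos j)
        (λ pₖⱼ → inj₁ (pᵢₖ , pₖⱼ , vⱼₖ , val<top k))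
        (inj₂ ∘ inj₂ ∘ pos-injective)
        (λ pⱼₖ → inj₂ (inj₁ (pⱼₖ , pos<top k , vⱼₖ , val<top k))) }
    ; e∉Q     = λ (_ , vⱼⱼ) → ℕₚ.<-irrefl refl vⱼⱼ
    }

  occurrence-R₂ : ∀ i j → T (isOcc R₂ v i j) ⇔ Max.IsExtremum pos (i ≺_) j
  occurrence-R₂ i j = no-larger⇔maximum ⇔-∘ occurrence⇔ (f2 , f2) (f2 , f1) λ (pᵢⱼ , vᵢⱼ) → record
    { A⊆Q     = λ (pⱼₖ , _ , vⱼₖ , _) → (ℕₚ.<-trans pᵢⱼ pⱼₖ , ℕₚ.<-trans vᵢⱼ vⱼₖ) , pⱼₖ
    ; B⊆Q     = λ (pⱼₖ , _ , vᵢₖ , _) → (ℕₚ.<-trans pᵢⱼ pⱼₖ , vᵢₖ) , pⱼₖ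
    ; Q⊆A∪B∪e = λ { {k} ((_ , vᵢₖ) , pⱼₖ) → by-comparing (val v k) (val v j)
        (λ vₖⱼ → inj₂ (inj₁ (pⱼₖ , pos<top k , vᵢₖ , vₖⱼ)))
        (inj₂ ∘ inj₂ ∘ val-injective)
        (λ vⱼₖ → inj₁ (pⱼₖ , pos<top k , vⱼₖ , val<top k)) }
    ; e∉Q     = λ (_ , pⱼⱼ) → ℕₚ.<-irrefl refl pⱼⱼ
    }

  occurrence-R₅ : ∀ i j → T (isOcc R₅ v i j) ⇔ Min.IsExtremum pos (i ≺_) j
  occurrence-R₅ i j = no-smaller⇔minimum ⇔-∘ occurrence⇔ (f1 , f2) (f1 , f1) λ (pᵢⱼ , vᵢⱼ) → record
    { A⊆Q     = λ (pᵢₖ , pₖⱼ , vⱼₖ , _) → (pᵢₖ , ℕₚ.<-trans vᵢⱼ vⱼₖ) , pₖⱼ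
    ; B⊆Q     = λ (pᵢₖ , pₖⱼ , vᵢₖ , _) → (pᵢₖ , vᵢₖ) , pₖⱼ
    ; Q⊆A∪B∪e = λ { {k} ((pᵢₖ , vᵢₖ) , pₖⱼ) → by-comparing (val v k) (val v j)
        (λ vₖⱼ → inj₂ (inj₁ (pᵢₖ , pₖⱼ , vᵢₖ , vₖⱼ)))
        (inj₂ ∘ inj₂ ∘ val-injective)
        (λ vⱼₖ → inj₁ (pᵢₖ , pₖⱼ , vⱼₖ , val<top k)) }
    ; e∉Q     = λ (_ , pⱼⱼ) → ℕₚ.<-irrefl refl pⱼⱼ
    }

  occurrence-R₇ : ∀ i j → T (isOcc R₇ v i j) ⇔ Min.IsExtremum (val v) (i ≺_) j
  occurrence-R₇ i j = no-smaller⇔minimum ⇔-∘ occurrence⇔ (f1 , f1) (f2 , f1) λ (pᵢⱼ , vᵢⱼ) → record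
    { A⊆Q     = λ (pᵢₖ , _ , vᵢₖ , vₖⱼ) → (pᵢₖ , vᵢₖ) , vₖⱼ
    ; B⊆Q     = λ (pⱼₖ , _ , vᵢₖ , vₖⱼ) → (ℕₚ.<-trans pᵢⱼ pⱼₖ , vᵢₖ) , vₖⱼ
    ; Q⊆A∪B∪e = λ { {k} ((pᵢₖ , vᵢₖ) , vₖⱼ) → by-comparing (pos k) (pos j)
        (λ pₖⱼ → inj₁ (pᵢₖ , pₖⱼ , vᵢₖ , vₖⱼ))
        (inj₂ ∘ inj₂ ∘ pos-injective)
        (λ pⱼₖ → inj₂ (inj₁ (pⱼₖ , pos<top k , vᵢₖ , vₖⱼ))) }
    ; e∉Q     = λ (_ , vⱼⱼ) → ℕₚ.<-irrefl refl vⱼⱼ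
    }

  occurrence-R₃ : ∀ i j → T (isOcc R₃ v i j) ⇔ Min.IsExtremum pos (_≺ j) i
  occurrence-R₃ i j = no-smaller⇔minimum ⇔-∘ occurrence⇔ (f0 , f1) (f0 , f0) λ (pᵢⱼ , vᵢⱼ) → record
    { A⊆Q     = λ (_ , pₖᵢ , _ , vₖⱼ) → (ℕₚ.<-trans pₖᵢ pᵢⱼ , vₖⱼ) , pₖᵢ
    ; B⊆Q     = λ (_ , pₖᵢ , _ , vₖᵢ) → (ℕₚ.<-trans pₖᵢ pᵢⱼ , ℕₚ.<-trans vₖᵢ vᵢⱼ) , pₖᵢ
    ; Q⊆A∪B∪e = λ { {k} ((_ , vₖⱼ) , pₖᵢ) → by-comparing (val v k) (val v i)
        (λ vₖᵢ → inj₂ (inj₁ (0<pos k , pₖᵢ , 0<val k , vₖᵢ)))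
        (inj₂ ∘ inj₂ ∘ val-injective)
        (λ vᵢₖ → inj₁ (0<pos k , pₖᵢ , vᵢₖ , vₖⱼ)) }
    ; e∉Q     = λ (_ , pᵢᵢ) → ℕₚ.<-irrefl refl pᵢᵢ
    }

  occurrence-R₄ : ∀ i j → T (isOcc R₄ v i j) ⇔ Min.IsExtremum (val v) (_≺ j) i
  occurrence-R₄ i j = no-smaller⇔minimum ⇔-∘ occurrence⇔ (f0 , f0) (f1 , f0) λ (pᵢⱼ , vᵢⱼ) → record
    { A⊆Q     = λ (_ , pₖᵢ , _ , vₖᵢ) → (ℕₚ.<-trans pₖᵢ pᵢⱼ , ℕₚ.<-trans vₖᵢ vᵢⱼ) , vₖᵢ
    ; B⊆Q     = λ (_ , pₖⱼ , _ , vₖᵢ) → (pₖⱼ , ℕₚ.<-trans vₖᵢ vᵢⱼ) , vₖᵢ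
    ; Q⊆A∪B∪e = λ { {k} ((pₖⱼ , _) , vₖᵢ) → by-comparing (pos k) (pos i)
        (λ pₖᵢ → inj₁ (0<pos k , pₖᵢ , 0<val k , vₖᵢ))
        (inj₂ ∘ inj₂ ∘ pos-injective)
        (λ pᵢₖ → inj₂ (inj₁ (pᵢₖ , pₖⱼ , 0<val k , vₖᵢ))) }
    ; e∉Q     = λ (_ , vᵢᵢ) → ℕₚ.<-irrefl refl vᵢᵢ
    }

  occurrence-R₆ : ∀ i j → T (isOcc R₆ v i j) ⇔ Max.IsExtremum (val v) (_≺ j) i
  occurrence-R₆ i j = no-larger⇔maximum ⇔-∘ occurrence⇔ (f0 , f1) (f1 , f1) λ (pᵢⱼ , vᵢⱼ) → record
    { A⊆Q     = λ (_ , pₖᵢ , vᵢₖ , vₖⱼ) → (ℕₚ.<-trans pₖᵢ pᵢⱼ , vₖⱼ) , vᵢₖ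
    ; B⊆Q     = λ (_ , pₖⱼ , vᵢₖ , vₖⱼ) → (pₖⱼ , vₖⱼ) , vᵢₖ
    ; Q⊆A∪B∪e = λ { {k} ((pₖⱼ , vₖⱼ) , vᵢₖ) → by-comparing (pos k) (pos i)
        (λ pₖᵢ → inj₁ (0<pos k , pₖᵢ , vᵢₖ , vₖⱼ))
        (inj₂ ∘ inj₂ ∘ pos-injective)
        (λ pᵢₖ → inj₂ (inj₁ (pᵢₖ , pₖⱼ , vᵢₖ , vₖⱼ))) }
    ; e∉Q     = λ (_ , vᵢᵢ) → ℕₚ.<-irrefl refl vᵢᵢ
    }

  occurrence-R₈ : ∀ i j → T (isOcc R₈ v i j) ⇔ Max.IsExtremum pos (_≺ j) i
  occurrence-R₈ i j = no-larger⇔maximum ⇔-∘ occurrence⇔ (f1 , f1) (f1 , f0) λ (pᵢⱼ , vᵢⱼ) → record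
    { A⊆Q     = λ (pᵢₖ , pₖⱼ , _ , vₖⱼ) → (pₖⱼ , vₖⱼ) , pᵢₖ
    ; B⊆Q     = λ (pᵢₖ , pₖⱼ , _ , vₖᵢ) → (pₖⱼ , ℕₚ.<-trans vₖᵢ vᵢⱼ) , pᵢₖ
    ; Q⊆A∪B∪e = λ { {k} ((pₖⱼ , vₖⱼ) , pᵢₖ) → by-comparing (val v k) (val v i)
        (λ vₖᵢ → inj₂ (inj₁ (pᵢₖ , pₖⱼ , 0<val k , vₖᵢ)))
        (inj₂ ∘ inj₂ ∘ val-injective)
        (λ vᵢₖ → inj₁ (pᵢₖ , pₖⱼ , vᵢₖ , vₖⱼ)) }
    ; e∉Q     = λ (_ , pᵢᵢ) → ℕₚ.<-irrefl refl pᵢᵢ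
    }

  module _ {_⊑_ : ℕ → ℕ → Set} (⊑-isTotalOrder : IsTotalOrder _≡_ _⊑_)
           {key : Fin n → ℕ} (key-injective : ∀ {a b} → key a ≡ key b → a ≡ b) (R : Shading) where
    open Extremum ⊑-isTotalOrder

    occ≡nonRLmaxima : (∀ i j → T (isOcc R v i j) ⇔ IsExtremum key (i ≺_) j) → occ R v ≡ nonRLmaxima v
    occ≡nonRLmaxima occurrence = begin
      occ R v
        ≡⟨ occ-as-sum R v ⟩
      ∑[ i < n ] ∑[ j < n ] 𝟙 (isOcc R v i j)
        ≡⟨ sum-cong-≗ {n} (λ i → ∑-𝟙-extremum key-injective (i ≺?_) (isOcc R v i) (occurrence i)) ⟩
      ∑[ i < n ] 𝟙 (does (any? (i ≺?_)))
        ≡⟨ sum-cong-≗ {n} (λ i → 𝟙-does-cong (∃-cong (≺⇔NonInversion i))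
                                              (any? (i ≺?_)) (any? (nonInversion? v i))) ⟩
      nonRLmaxima v
        ∎
      where open ≡-Reasoning

    occ≡nonLRminima : (∀ i j → T (isOcc R v i j) ⇔ IsExtremum key (_≺ j) i) → occ R v ≡ nonLRminima v
    occ≡nonLRminima occurrence = begin
      occ R v
        ≡⟨ occ-as-sum R v ⟩
      ∑[ i < n ] ∑[ j < n ] 𝟙 (isOcc R v i j)
        ≡⟨ ∑-comm (λ i j → 𝟙 (isOcc R v i j)) ⟩
      ∑[ j < n ] ∑[ i < n ] 𝟙 (isOcc R v i j)
        ≡⟨ sum-cong-≗ {n} (λ j → ∑-𝟙-extremum key-injective (_≺? j) (λ i → isOcc R v i j)
                                                             (λ i → occurrence i j)) ⟩
      ∑[ j < n ] 𝟙 (does (any? (_≺? j)))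
        ≡⟨ sum-cong-≗ {n} (λ j → 𝟙-does-cong (∃-cong (λ i → ≺⇔NonInversion i j))
                                              (any? (_≺? j)) (any? (λ i → nonInversion? v i j))) ⟩
      nonLRminima v
        ∎
      where open ≡-Reasoning

  occ-R₁ : occ R₁ v ≡ nonRLmaxima v
  occ-R₁ = occ≡nonRLmaxima ℕₚ.≤-isTotalOrder val-injective R₁ occurrence-R₁

  occ-R₂ : occ R₂ v ≡ nonRLmaxima v
  occ-R₂ = occ≡nonRLmaxima ℕₚ.≤-isTotalOrder pos-injective R₂ occurrence-R₂

  occ-R₃ : occ R₃ v ≡ nonLRminima v
  occ-R₃ = occ≡nonLRminima ≥-isTotalOrder pos-injective R₃ occurrence-R₃

  occ-R₄ : occ R₄ v ≡ nonLRminima v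
  occ-R₄ = occ≡nonLRminima ≥-isTotalOrder val-injective R₄ occurrence-R₄

  occ-R₅ : occ R₅ v ≡ nonRLmaxima v
  occ-R₅ = occ≡nonRLmaxima ≥-isTotalOrder pos-injective R₅ occurrence-R₅

  occ-R₆ : occ R₆ v ≡ nonLRminima v
  occ-R₆ = occ≡nonLRminima ℕₚ.≤-isTotalOrder val-injective R₆ occurrence-R₆

  occ-R₇ : occ R₇ v ≡ nonRLmaxima v
  occ-R₇ = occ≡nonRLmaxima ≥-isTotalOrder val-injective R₇ occurrence-R₇

  occ-R₈ : occ R₈ v ≡ nonLRminima v
  occ-R₈ = occ≡nonLRminima ℕₚ.≤-isTotalOrder pos-injective R₈ occurrence-R₈

s≡dist : ∀ {R : Shading} (stat : Statistic) →
         (∀ {n} (v : Vec (Fin n) n) → T (isPerm v) → occ R v ≡ stat v) →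
         ∀ n k → s R n k ≡ dist stat n k
s≡dist stat occ≡stat n k = count-perms-cong {n} (λ v v-perm → cong (_≡ᵇ k) (occ≡stat v v-perm))

s≡stirlingᵣ-via-nonRLmaxima : ∀ {R : Shading} →
                              (∀ {n} (v : Vec (Fin n) n) → Injective v → occ R v ≡ nonRLmaxima v) →
                              ∀ n k → s R n k ≡ stirlingᵣ n k
s≡stirlingᵣ-via-nonRLmaxima {R} occ≡ n k =
  trans (s≡dist {R} nonRLmaxima (λ v → occ≡ v ∘ isPerm⇒Injective v) n k)
        (dist≡stirlingᵣ refl nonRLmaxima-insertion n k)

s≡stirlingᵣ-via-nonLRminima : ∀ {R : Shading} →
                              (∀ {n} (v : Vec (Fin n) n) → Injective v → occ R v ≡ nonLRminima v) →
                              ∀ n k → s R n k ≡ stirlingᵣ n k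
s≡stirlingᵣ-via-nonLRminima {R} occ≡ n k =
  trans (s≡dist {R} nonLRminima (λ v → occ≡ v ∘ isPerm⇒Injective v) n k)
        (dist≡stirlingᵣ refl nonLRminima-insertion n k)

s≡stirlingᵣ : ∀ R → R ∈ theShadings → ∀ n k → s R n k ≡ stirlingᵣ n k
s≡stirlingᵣ _ (here refl)                         = s≡stirlingᵣ-via-nonRLmaxima {R₁} Mesh.occ-R₁
s≡stirlingᵣ _ (there (here refl))                 = s≡stirlingᵣ-via-nonRLmaxima {R₂} Mesh.occ-R₂
s≡stirlingᵣ _ (there (there (here refl)))         = s≡stirlingᵣ-via-nonLRminima {R₃} Mesh.occ-R₃
s≡stirlingᵣ _ (there (there (there (here refl)))) = s≡stirlingᵣ-via-nonLRminima {R₄} Mesh.occ-R₄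
s≡stirlingᵣ _ (there (there (there (there R∈)))) with R∈
... | here refl                         = s≡stirlingᵣ-via-nonRLmaxima {R₅} Mesh.occ-R₅
... | there (here refl)                 = s≡stirlingᵣ-via-nonLRminima {R₆} Mesh.occ-R₆
... | there (there (here refl))         = s≡stirlingᵣ-via-nonRLmaxima {R₇} Mesh.occ-R₇
... | there (there (there (here refl))) = s≡stirlingᵣ-via-nonLRminima {R₈} Mesh.occ-R₈

-- The generating polynomial

sum-map-upTo : ∀ m (f : ℕ → ℕ) → ListAction.sum (map f (upTo m)) ≡ ∑[ i < m ] f (toℕ i)
sum-map-upTo m f = trans (cong ListAction.sum (map-applyUpTo (λ i → i) f m)) (sum-applyUpTo m f)
  where
  sum-applyUpTo : ∀ m (f : ℕ → ℕ) → ListAction.sum (applyUpTo f m) ≡ ∑[ i < m ] f (toℕ i)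
  sum-applyUpTo zero    f = refl
  sum-applyUpTo (suc m) f = cong (f 0 +_) (sum-applyUpTo m (f ∘ suc))

∑-last : ∀ m (f : ℕ → ℕ) → ∑[ i < suc m ] f (toℕ i) ≡ ∑[ i < m ] f (toℕ i) + f m
∑-last m f = trans (sum-init-last {m} (f ∘ toℕ))
  (cong₂ _+_ (sum-cong-≗ {m} (cong f ∘ toℕ-inject₁)) (cong f (toℕ-fromℕ m)))

stirlingᵣ-vanishes : ∀ {n k} → n < k → stirlingᵣ n k ≡ 0
stirlingᵣ-vanishes {zero}  {suc k} _ = refl
stirlingᵣ-vanishes {suc n} {suc k} (s<s n<k)
  rewrite stirlingᵣ-vanishes {n} {suc k} (ℕₚ.m<n⇒m<1+n n<k) | stirlingᵣ-vanishes n<k = ℕₚ.*-zeroʳ n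

stirlingPoly : ℕ → ℕ → ℕ
stirlingPoly n q = ∑[ k < suc n ] (stirlingᵣ n (toℕ k) * q ^ toℕ k)

stirlingPoly-suc : ∀ n q → stirlingPoly (suc n) q ≡ stirlingPoly n q * (1 + n * q)
stirlingPoly-suc n q = begin
  stirlingPoly (suc n) q
    ≡⟨⟩
  c n 0 * 1 + ∑[ k < suc n ] ((c n (suc (toℕ k)) + n * c n (toℕ k)) * (q * q ^ toℕ k))
    ≡⟨ cong (c n 0 * 1 +_) (sum-cong-≗ {suc n} λ k →
         split (c n (suc (toℕ k))) n (c n (toℕ k)) q (q ^ toℕ k)) ⟩
  c n 0 * 1 + ∑[ k < suc n ] (c n (suc (toℕ k)) * q ^ suc (toℕ k) + n * q * (c n (toℕ k) * q ^ toℕ k))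
    ≡⟨ cong (c n 0 * 1 +_) (∑-distrib-+ {suc n} (λ k → c n (suc (toℕ k)) * q ^ suc (toℕ k))
                                                 (λ k → n * q * (c n (toℕ k) * q ^ toℕ k))) ⟩
  c n 0 * 1 + (∑[ k < suc n ] (c n (suc (toℕ k)) * q ^ suc (toℕ k)) +
               ∑[ k < suc n ] (n * q * (c n (toℕ k) * q ^ toℕ k)))
    ≡⟨ ℕₚ.+-assoc (c n 0 * 1) _ _ ⟨
  ∑[ k < suc (suc n) ] (c n (toℕ k) * q ^ toℕ k) + ∑[ k < suc n ] (n * q * (c n (toℕ k) * q ^ toℕ k))
    ≡⟨ cong₂ _+_ (∑-last (suc n) (λ k → c n k * q ^ k))
                 (sym (*-distribˡ-sum {suc n} (n * q) (λ k → c n (toℕ k) * q ^ toℕ k))) ⟩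
  stirlingPoly n q + c n (suc n) * q ^ suc n + n * q * stirlingPoly n q
    ≡⟨ cong (λ x → stirlingPoly n q + x * q ^ suc n + n * q * stirlingPoly n q)
            (stirlingᵣ-vanishes (ℕₚ.n<1+n n)) ⟩
  stirlingPoly n q + 0 * q ^ suc n + n * q * stirlingPoly n q
    ≡⟨ collect (stirlingPoly n q) (q ^ suc n) (n * q) ⟩
  stirlingPoly n q * (1 + n * q)
    ∎
  where
  open ≡-Reasoning
  c = stirlingᵣ
  split : ∀ a n b q r → (a + n * b) * (q * r) ≡ a * (q * r) + n * q * (b * r)
  split = solve-∀
  collect : ∀ p r m → p + 0 * r + m * p ≡ p * (1 + m)
  collect = solve-∀

egfCoeff-suc : ∀ n q → egfCoeff (suc n) q ≡ egfCoeff n q * (1 + n * q)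
egfCoeff-suc n q = begin
  product (map f (upTo (suc n)))        ≡⟨ cong product (map-applyUpTo (λ i → i) f (suc n)) ⟩
  product (applyUpTo f (suc n))         ≡⟨ cong product (applyUpTo-∷ʳ f n) ⟨
  product (applyUpTo f n List.∷ʳ f n)   ≡⟨ product-++ (applyUpTo f n) (f n ∷ []) ⟩
  product (applyUpTo f n) * (f n * 1)   ≡⟨ cong₂ _*_ (cong product (sym (map-applyUpTo (λ i → i) f n)))
                                                     (ℕₚ.*-identityʳ (f n)) ⟩
  egfCoeff n q * (1 + n * q)            ∎
  where
  open ≡-Reasoning
  f : ℕ → ℕ
  f i = 1 + i * q

stirlingPoly≡egfCoeff : ∀ n q → stirlingPoly n q ≡ egfCoeff n q
stirlingPoly≡egfCoeff zero    q = refl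
stirlingPoly≡egfCoeff (suc n) q = begin
  stirlingPoly (suc n) q          ≡⟨ stirlingPoly-suc n q ⟩
  stirlingPoly n q * (1 + n * q)  ≡⟨ cong (_* (1 + n * q)) (stirlingPoly≡egfCoeff n q) ⟩
  egfCoeff n q * (1 + n * q)      ≡⟨ egfCoeff-suc n q ⟨
  egfCoeff (suc n) q              ∎
  where open ≡-Reasoning

genPoly≡stirlingPoly : ∀ {R : Shading} → (∀ n k → s R n k ≡ stirlingᵣ n k) →
                       ∀ n q → genPoly R n q ≡ stirlingPoly n q
genPoly≡stirlingPoly {R} s≡ n q = trans (sum-map-upTo (suc n) (λ k → s R n k * q ^ k))
  (sum-cong-≗ {suc n} (λ k → cong (_* q ^ toℕ k) (s≡ n (toℕ k))))

theorem5p1 :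
  ((R R′ : Shading) → R ∈ theShadings → R′ ∈ theShadings →
    (n k : ℕ) → s R n k ≡ s R′ n k)
  ×
  ((R : Shading) → R ∈ theShadings →
      ((n k : ℕ) → s R (suc n) (suc k) ≡ s R n (suc k) + n * s R n k)
    × ((n : ℕ) → s R (suc n) 0 ≡ s R n 0)
    × (s R 0 0 ≡ 1) × (s R 1 0 ≡ 1) × (s R 1 1 ≡ 0)
    × ((n k : ℕ) → k ≤ n → s R n k ≡ stirling1 n (n ∸ k))
    × ((n q : ℕ) → genPoly R n q ≡ egfCoeff n q))
theorem5p1 =
  (λ R R′ R∈ R′∈ n k → trans (s≡stirlingᵣ R R∈ n k) (sym (s≡stirlingᵣ R′ R′∈ n k))) ,
  λ R R∈ → let s≡ = s≡stirlingᵣ R R∈ in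
    (λ n k → trans (s≡ (suc n) (suc k)) (sym (cong₂ (λ a b → a + n * b) (s≡ n (suc k)) (s≡ n k)))) ,
    (λ n → trans (s≡ (suc n) 0) (sym (s≡ n 0))) ,
    s≡ 0 0 , s≡ 1 0 , s≡ 1 1 ,
    (λ n k k≤n → trans (s≡ n k)
                   (sym (trans (stirling1≡dist-nonLeaders k≤n) (dist≡stirlingᵣ refl nonLeaders-insertion n k)))) ,
    (λ n q → trans (genPoly≡stirlingPoly {R} s≡ n q) (stirlingPoly≡egfCoeff n q))
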